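{- Let $\sigma,\sigma'$ be configurations of a threshold automaton. (1) If $\phi_{\mathit{reach}}(\sigma,\sigma')$ is true with the values $(z_r)_{r\in\mathcal R}$ for the existential variables $(\mathit{sum}_r)_{r\in\mathcal R}$, then there is a finite schedule $\tau$ applicable to $\sigma$ with $\tau(\sigma)=\sigma'$ such that $\tau(r)=z_r$ for all rules $r$. (2) Conversely, if $\tau$ is a finite schedule applicable to $\sigma$ with $\tau(\sigma)=\sigma'$, then $\phi_{\mathit{reach}}(\sigma,\sigma')$ can be satisfied with the values $(\tau(r))_{r\in\mathcal R}$ for the variables $(\mathit{sum}_r)_{r\in\mathcal R}$. Here $\tau(r)$ denotes the number of occurrences of $r$ in $\tau$.
   Context: A threshold automaton $\mathsf{TA}=(\mathcal L,\mathcal I,\Gamma,\mathcal R)$ over environment $(\Pi,RC,N)$ ($\Pi$ parameters over $\mathbb N_0$, $RC\subseteq\mathbb N_0^\Pi$ integer-linear-definable, $N$ linear) has locations $\mathcal L$, shared variables $\Gamma$ over $\mathbb N_0$, and rules $r=(r.\mathit{from},r.\mathit{to},r.\varphi,r.\vec u)$ with $r.\varphi$ a conjunction of threshold guards (rise: $x\ge a_0+\sum_ia_ip_i$; fall: $x<a_0+\sum_ia_ip_i$; $x\in\Gamma,p_i\in\Pi,a_i\in\mathbb Q$) and $r.\vec u\in\{0,1\}^\Gamma$; let $\Phi$ be the set of guards occurring in rules. A configuration $\sigma=(\sigma.\kappa,\sigma.\vec g,\sigma.\vec p)$ has $\sigma.\kappa\colon\mathcal L\to\mathbb N_0$, $\sigma.\vec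 g\in\mathbb N_0^\Gamma$, $\sigma.\vec p\in RC$, $\sum_\ell\sigma.\kappa(\ell)=N(\sigma.\vec p)$. $\sigma\models r.\varphi$ means $(\sigma.\vec g,\sigma.\vec p)$ satisfies $r.\varphi$. $\sigma$ enables $r$ if $\sigma.\kappa(r.\mathit{from})>0$ and $\sigma\models r.\varphi$; then $r(\sigma)$ keeps parameters, has shared values $\sigma.\vec g+r.\vec u$ and moves one process from $r.\mathit{from}$ to $r.\mathit{to}$. A finite schedule $r_1\dots r_m$ is applicable to $\sigma_0$ if $r_i$ is enabled in $\sigma_{i-1}$ with $\sigma_i=r_i(\sigma_{i-1})$; $\tau(\sigma_0)=\sigma_m$. The context $\omega(\sigma)$ is the set of rise guards in $\Phi$ true in $\sigma$ plus fall guards in $\Phi$ false in $\sigma$. For configurations $\sigma,\sigma'$ and $X=(x_r)_{r\in\mathcal R}\in\mathbb N_0^{\mathcal R}$ consider: (base) $\sigma.\vec p=\sigma'.\vec p$, $\sigma.\vec p\in RC$, $N(\sigma.\vec p)=N(\sigma'.\vec p)$, $\omega(\sigma)=\omega(\sigma')$; (L) for all $\ell$: $\sum_{r.\mathit{to}=\ell}x_r-\sum_{r.\mathit{from}=\ell}x_r=\sigma'.\kappa(\ell)-\sigma.\kappa(\ell)$; ($\Gamma$) for all $z\in\Gamma$: $\sum_rx_r\,r.\vec u[z]=\sigma'.\vec g[z]-\sigma.\vec g[z]$; (R) $x_r>0\Rightarrow\sigma\models r.\varphi$ for all $r$; (appl) for every $r$ with $x_r>0$ there are rules $r_1,\dots,r_s$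 with all $x_{r_i}>0$, $\sigma.\kappa(r_1.\mathit{from})>0$, $r_{i-1}.\mathit{to}=r_i.\mathit{from}$ for $1<i\le s$, $r_s=r$. $\phi_{\mathit{steady}}(\sigma,\sigma')\equiv(\text{base})\wedge\exists X\ge0[(\text{L})\wedge(\Gamma)\wedge(\text{R})\wedge(\text{appl})]$. $\phi_{\mathit{step}}(\eta,\eta')$ is defined like $\phi_{\mathit{steady}}(\eta,\eta')$ but without the requirement $\omega(\eta)=\omega(\eta')$ and with the extra constraint $\sum_rx_r\le1$. With $K=|\Phi|+1$, $\phi_{\mathit{reach}}(\sigma,\sigma')$ is $\exists\sigma_0,\sigma'_0,\dots,\sigma_K,\sigma'_K\ \big(\sigma_0=\sigma\wedge\sigma'_K=\sigma'\wedge\bigwedge_{0\le i\le K}\phi_{\mathit{steady}}(\sigma_i,\sigma'_i)\wedge\bigwedge_{0\le i\le K-1}\phi_{\mathit{step}}(\sigma'_i,\sigma_{i+1})\big)$, where the existential variables of $\phi_{\mathit{steady}}(\sigma_i,\sigma'_i)$ are denoted $x^i_r$ and those of $\phi_{\mathit{step}}(\sigma'_i,\sigma_{i+1})$ are denoted $y^i_r$, and additionally, for each rule $r$, there is an existential variable $\mathit{sum}_r$ constrained by $\mathit{sum}_r=\sum_{i=0}^Kx^i_r+\sum_{i=0}^{K-1}y^i_r$. -}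

module Defs where

open import Data.Nat as ℕ using (ℕ; zero; suc; _>_; _≤_)
open import Data.Integer as ℤ using (ℤ; +_)
open import Data.Rational as ℚ using (ℚ; _/_)
import Data.Rational.Properties as ℚP
open import Data.Fin as Fin using (Fin; zero; suc; inject₁; fromℕ)
open import Data.Fin.Properties using () renaming (_≟_ to _≟ᶠ_)
open import Data.Vec as Vec using (Vec)
import Data.Vec.Properties as VecP
open import Data.List as List using (List; []; _∷_)
open import Data.List.Membership.Propositional using (_∈_)
open import Data.Bool using (Bool; true; false; if_then_else_)
open import Data.Product using (Σ; ∃; ∃-syntax; _×_; _,_)
open import Data.Sum using (_⊎_)
open import Relation.Nullary using (¬_; Dec; yes; no; does)
open import Relation.Nullary.Decidable using (map′; _×-dec_)
open import Relation.Binary.PropositionalEquality using (_≡_; refl; cong; cong₂)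
open import Function.Bundles using (_⇔_)

Σℕ : (n : ℕ) → (Fin n → ℕ) → ℕ
Σℕ zero    f = 0
Σℕ (suc n) f = f zero ℕ.+ Σℕ n (λ i → f (suc i))

Σℤ : (n : ℕ) → (Fin n → ℤ) → ℤ
Σℤ zero    f = + 0
Σℤ (suc n) f = f zero ℤ.+ Σℤ n (λ i → f (suc i))

Σℚ : (n : ℕ) → (Fin n → ℚ) → ℚ
Σℚ zero    f = ℚ.0ℚ
Σℚ (suc n) f = f zero ℚ.+ Σℚ n (λ i → f (suc i))

ℕtoℚ : ℕ → ℚ
ℕtoℚ n = (+ n) / 1

bit : Bool → ℕ
bit true  = 1
bit false = 0

-- Threshold guards over shared variables Fin nG and parameters Fin nP
-- rise :  x ≥ a₀ + Σ aᵢ pᵢ      fall :  x < a₀ + Σ aᵢ pᵢ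

data GuardKind : Set where
  rise fall : GuardKind

record Guard (nG nP : ℕ) : Set where
  constructor guard
  field
    kind  : GuardKind
    var   : Fin nG
    a₀    : ℚ
    coeff : Vec ℚ nP
open Guard public

kind-dec : (k k' : GuardKind) → Dec (k ≡ k')
kind-dec rise rise = yes refl
kind-dec rise fall = no λ ()
kind-dec fall rise = no λ ()
kind-dec fall fall = yes refl

guard-dec : ∀ {nG nP} (g h : Guard nG nP) → Dec (g ≡ h)
guard-dec (guard k x a c) (guard k' x' a' c') =
  map′ (λ { (refl , refl , refl , refl) → refl })
       (λ { refl → refl , refl , refl , refl })
       (kind-dec k k' ×-dec (x ≟ᶠ x') ×-dec (a ℚP.≟ a') ×-dec VecP.≡-dec ℚP._≟_ c c')

-- Threshold automaton together with its environment (Π, RC, N).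
-- Locations Fin nL, shared variables Fin nG, parameters Fin nP, rules Fin nR.

record Rule (nL nG nP : ℕ) : Set where
  field
    from   : Fin nL
    to     : Fin nL
    φ      : List (Guard nG nP)
    u      : Fin nG → Bool
open Rule public

record TA : Set₁ where
  field
    nL nG nP nR : ℕ
    rules : Fin nR → Rule nL nG nP
    RC    : (Fin nP → ℕ) → Set
    -- N is linear:  N(p) = N₀ + Σ Nᵢ pᵢ
    N₀    : ℤ
    Ncoef : Fin nP → ℤ

module _ (A : TA) where
  open TA A

  N : (Fin nP → ℕ) → ℤ
  N p = N₀ ℤ.+ Σℤ nP (λ i → Ncoef i ℤ.* (+ p i))

  record Config : Set where
    field
      κ  : Fin nL → ℕ
      gv : Fin nG → ℕ
      pv : Fin nP → ℕ
  open Config public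

  IsConfig : Config → Set
  IsConfig σ = RC (pv σ) × (+ Σℕ nL (κ σ)) ≡ N (pv σ)

  _≈_ : Config → Config → Set
  σ ≈ σ' = (∀ ℓ → κ σ ℓ ≡ κ σ' ℓ) × (∀ z → gv σ z ≡ gv σ' z) × (∀ i → pv σ i ≡ pv σ' i)

  bound : Guard nG nP → (Fin nP → ℕ) → ℚ
  bound g p = a₀ g ℚ.+ Σℚ nP (λ i → Vec.lookup (coeff g) i ℚ.* ℕtoℚ (p i))

  _⊨g_ : Config → Guard nG nP → Set
  σ ⊨g g with kind g
  ... | rise = bound g (pv σ) ℚ.≤ ℕtoℚ (gv σ (var g))
  ... | fall = ℕtoℚ (gv σ (var g)) ℚ.< bound g (pv σ)

  _⊨_ : Config → List (Guard nG nP) → Set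
  σ ⊨ [] = ⊤′
    where open import Data.Unit using () renaming (⊤ to ⊤′)
  σ ⊨ (g ∷ gs) = (σ ⊨g g) × (σ ⊨ gs)

  Φ : List (Guard nG nP)
  Φ = List.concatMap (λ r → φ (rules r)) (List.allFin nR)

  ∣Φ∣ : ℕ
  ∣Φ∣ = List.length (List.deduplicate guard-dec Φ)

  K : ℕ
  K = suc ∣Φ∣

  ω : Config → Guard nG nP → Set
  ω σ g = g ∈ Φ × ((kind g ≡ rise × σ ⊨g g) ⊎ (kind g ≡ fall × ¬ (σ ⊨g g)))

  SameContext : Config → Config → Set
  SameContext σ σ' = ∀ g → ω σ g ⇔ ω σ' g

  δ : Fin nL → Fin nL → ℕ
  δ a b = if does (a ≟ᶠ b) then 1 else 0

  Enabled : Config → Fin nR → Set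
  Enabled σ r = κ σ (from (rules r)) > 0 × σ ⊨ φ (rules r)

  apply : Fin nR → Config → Config
  apply r σ = record
    { κ  = λ ℓ → (κ σ ℓ ℕ.∸ δ (from (rules r)) ℓ) ℕ.+ δ (to (rules r)) ℓ
    ; gv = λ z → gv σ z ℕ.+ bit (u (rules r) z)
    ; pv = pv σ }

  Schedule : Set
  Schedule = List (Fin nR)

  data Run : Config → Schedule → Config → Set where
    done : ∀ {σ σ'} → σ ≈ σ' → Run σ [] σ'
    step : ∀ {σ r τ σ'} → Enabled σ r → Run (apply r σ) τ σ' → Run σ (r ∷ τ) σ'

  occ : Schedule → Fin nR → ℕ
  occ τ r = List.length (List.filter (λ r' → r ≟ᶠ r') τ)

  RuleVec : Set
  RuleVec = Fin nR → ℕ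

  -- (base) without the context condition
  Base₀ : Config → Config → Set
  Base₀ σ σ' = (∀ i → pv σ i ≡ pv σ' i) × RC (pv σ) × N (pv σ) ≡ N (pv σ')

  CondL : Config → Config → RuleVec → Set
  CondL σ σ' X = ∀ ℓ →
    Σℤ nR (λ r → if does (to (rules r) ≟ᶠ ℓ) then + X r else + 0)
      ℤ.- Σℤ nR (λ r → if does (from (rules r) ≟ᶠ ℓ) then + X r else + 0)
    ≡ (+ κ σ' ℓ) ℤ.- (+ κ σ ℓ)

  CondΓ : Config → Config → RuleVec → Set
  CondΓ σ σ' X = ∀ z →
    + Σℕ nR (λ r → X r ℕ.* bit (u (rules r) z)) ≡ (+ gv σ' z) ℤ.- (+ gv σ z)

  CondR : Config → RuleVec → Set
  CondR σ X = ∀ r → X r > 0 → σ ⊨ φ (rules r)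

  CondAppl : Config → RuleVec → Set
  CondAppl σ X = ∀ r → X r > 0 →
    ∃[ s ] Σ (Fin (suc s) → Fin nR) λ rs →
      (∀ i → X (rs i) > 0)
      × κ σ (from (rules (rs zero))) > 0
      × (∀ (i : Fin s) → to (rules (rs (inject₁ i))) ≡ from (rules (rs (suc i))))
      × rs (fromℕ s) ≡ r

  -- body of φ_steady(σ,σ') for a given witness X
  Steady : Config → Config → RuleVec → Set
  Steady σ σ' X = Base₀ σ σ' × SameContext σ σ'
                × CondL σ σ' X × CondΓ σ σ' X × CondR σ X × CondAppl σ X

  -- body of φ_step(η,η') for a given witness Y
  Step : Config → Config → RuleVec → Set
  Step η η' Y = Base₀ η η'
              × CondL η η' Y × CondΓ η η' Y × CondR η Y × CondAppl η Y
              × Σℕ nR Y ≤ 1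

  -- φ_reach(σ,σ') holds with the values z for the variables sum_r
  ReachWith : Config → Config → RuleVec → Set
  ReachWith σ σ' z =
    Σ (Fin (suc K) → Config) λ σs →
    Σ (Fin (suc K) → Config) λ σs' →
    Σ (Fin (suc K) → RuleVec) λ x →
    Σ (Fin K → RuleVec) λ y →
        (∀ i → IsConfig (σs i)) × (∀ i → IsConfig (σs' i))
      × σs zero ≈ σ × σs' (fromℕ K) ≈ σ'
      × (∀ i → Steady (σs i) (σs' i) (x i))
      × (∀ (i : Fin K) → Step (σs' (inject₁ i)) (σs (suc i)) (y i))
      × (∀ r → z r ≡ Σℕ (suc K) (λ i → x i r) ℕ.+ Σℕ K (λ i → y i r))

-- (1) Every steady or step segment of φ_reach is realised by a schedule, by induction on the
-- number of firings.  Follow used rules greedily from an occupied location until the walk is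
-- stuck at a location v, i.e. every rule leaving v is used no more often than in the walk.  The
-- walk enters v once more than it leaves it, so the flow equations put a process at v in the
-- target configuration: the last rule of the walk can be fired last, and removing that firing
-- leaves a smaller solution of the same kind.  Guards of used rules stay true throughout the
-- segment: rise guards only become true, and since the context is constant on a steady segment,
-- a fall guard that holds at its start still holds at its end.
-- (2) Conversely, cut a run just before each step that changes the context.  Contexts only grow,
-- so there are at most |Φ| cuts; the pieces, padded with empty segments, satisfy φ_steady and
-- φ_step.

module Submission where

open import Defs
open import Data.Bool using (Bool; true; false; if_then_else_)
open import Data.Empty using (⊥; ⊥-elim)
open import Data.Fin using (Fin; zero; suc; inject₁; fromℕ)
open import Data.Fin.Properties using (any?) renaming (_≟_ to _≟ᶠ_)
open import Data.Integer as ℤ using (ℤ)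
import Data.Integer.Properties as ℤP
import Data.Integer.Tactic.RingSolver as ℤ-Solver
open import Data.List as List using (List; []; _∷_; _++_)
open import Data.List.Membership.Propositional using (_∈_; find; lose)
open import Data.List.Membership.Propositional.Properties using (∈-concatMap⁺; ∈-allFin; ∈-deduplicate⁺)
open import Data.List.Properties using (length-filter)
open import Data.List.Relation.Unary.Any as Any using (here; there)
open import Data.Nat as ℕ using (ℕ; zero; suc; _≤_; _<_; z≤n; s≤s; _+_; _∸_; _*_; _≤?_; _<?_)
import Data.Nat.Properties as ℕP
open import Data.Nat.Coprimality using (1-coprimeTo) renaming (sym to coprime-sym)
open import Data.Nat.Tactic.RingSolver using (solve-∀)
open import Data.Product using (Σ; ∃-syntax; _×_; _,_; proj₁; proj₂)
open import Data.Rational as ℚ using (mkℚ)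
import Data.Rational.Properties as ℚP
open import Data.Sum using (_⊎_; inj₁; inj₂)
open import Data.Unit using (tt)
import Data.Vec as Vec
open import Function.Base using (_∘_)
open import Function.Bundles using (Equivalence; mk⇔; _⇔_)
open import Relation.Binary.PropositionalEquality
  using (_≡_; _≢_; refl; sym; trans; cong; cong₂; subst; module ≡-Reasoning)
open import Relation.Nullary using (¬_; Dec; yes; no; does; ¬?)
open import Relation.Nullary.Decidable using (dec-true; dec-false; map′; _×-dec_)
open import Relation.Unary using (Decidable)

ind : Bool → ℕ → ℕ
ind b x = if b then x else 0

ind-+ : ∀ b x y → ind b (x + y) ≡ ind b x + ind b y
ind-+ true  x y = refl
ind-+ false x y = refl

ind-0 : ∀ b → ind b 0 ≡ 0
ind-0 true  = refl
ind-0 false = refl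

ind-comm : ∀ b c x → ind b (ind c x) ≡ ind c (ind b x)
ind-comm true  c     x = refl
ind-comm false true  x = refl
ind-comm false false x = refl

ind-1-* : ∀ b x → ind b 1 * x ≡ ind b x
ind-1-* true  x = ℕP.+-identityʳ x
ind-1-* false x = refl

does-sym : ∀ {n} (i j : Fin n) → does (i ≟ᶠ j) ≡ does (j ≟ᶠ i)
does-sym i j with i ≟ᶠ j
... | yes i≡j = sym (dec-true (j ≟ᶠ i) (sym i≡j))
... | no  i≢j = sym (dec-false (j ≟ᶠ i) (λ j≡i → i≢j (sym j≡i)))

does-refl : ∀ {n} (i : Fin n) → does (i ≟ᶠ i) ≡ true
does-refl i = dec-true (i ≟ᶠ i) refl

does-≢ : ∀ {n} {i j : Fin n} → i ≢ j → does (i ≟ᶠ j) ≡ false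
does-≢ {i = i} {j} = dec-false (i ≟ᶠ j)

ind-≟-≤ : ∀ {n} (f : Fin n → ℕ) j → 1 ≤ f j → ∀ i → ind (does (j ≟ᶠ i)) 1 ≤ f i
ind-≟-≤ f j 1≤fj i with j ≟ᶠ i
... | yes refl = 1≤fj
... | no  _    = z≤n

Σℕ-cong : ∀ n {f g : Fin n → ℕ} → (∀ i → f i ≡ g i) → Σℕ n f ≡ Σℕ n g
Σℕ-cong zero    f≗g = refl
Σℕ-cong (suc n) f≗g = cong₂ _+_ (f≗g zero) (Σℕ-cong n (λ i → f≗g (suc i)))

Σℕ-+ : ∀ n (f g : Fin n → ℕ) → Σℕ n (λ i → f i + g i) ≡ Σℕ n f + Σℕ n g
Σℕ-+ zero    f g = refl
Σℕ-+ (suc n) f g =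
  trans (cong (f zero + g zero +_) (Σℕ-+ n (λ i → f (suc i)) (λ i → g (suc i))))
        (+-interchange (f zero) (g zero) _ _)
  where
  +-interchange : ∀ a b c d → (a + b) + (c + d) ≡ (a + c) + (b + d)
  +-interchange = solve-∀

Σℕ-0 : ∀ n {f : Fin n → ℕ} → (∀ i → f i ≡ 0) → Σℕ n f ≡ 0
Σℕ-0 zero    f≗0 = refl
Σℕ-0 (suc n) f≗0 = cong₂ _+_ (f≗0 zero) (Σℕ-0 n (λ i → f≗0 (suc i)))

Σℕ-mono-≤ : ∀ n {f g : Fin n → ℕ} → (∀ i → f i ≤ g i) → Σℕ n f ≤ Σℕ n g
Σℕ-mono-≤ zero    f≤g = z≤n
Σℕ-mono-≤ (suc n) f≤g = ℕP.+-mono-≤ (f≤g zero) (Σℕ-mono-≤ n (λ i → f≤g (suc i)))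

Σℕ-mono-< : ∀ n {f g : Fin n → ℕ} → (∀ i → f i ≤ g i) → ∀ j → f j < g j → Σℕ n f < Σℕ n g
Σℕ-mono-< (suc n) f≤g zero    fj<gj = ℕP.+-mono-<-≤ fj<gj (Σℕ-mono-≤ n (λ i → f≤g (suc i)))
Σℕ-mono-< (suc n) f≤g (suc j) fj<gj =
  ℕP.+-mono-≤-< (f≤g zero) (Σℕ-mono-< n (λ i → f≤g (suc i)) j fj<gj)

≤-Σℕ : ∀ n (f : Fin n → ℕ) j → f j ≤ Σℕ n f
≤-Σℕ (suc n) f zero    = ℕP.m≤m+n _ _
≤-Σℕ (suc n) f (suc j) = ℕP.≤-trans (≤-Σℕ n (λ i → f (suc i)) j) (ℕP.m≤n+m _ _)

Σℕ≡0⇒≡0 : ∀ n (f : Fin n → ℕ) → Σℕ n f ≡ 0 → ∀ i → f i ≡ 0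
Σℕ≡0⇒≡0 n f Σf≡0 i = ℕP.n≤0⇒n≡0 (subst (f i ≤_) Σf≡0 (≤-Σℕ n f i))

Σℕ>0⇒>0 : ∀ n (f : Fin n → ℕ) → 0 < Σℕ n f → ∃[ j ] 0 < f j
Σℕ>0⇒>0 (suc n) f Σf>0 with f zero in fzero≡
... | suc _ = zero , subst (0 <_) (sym fzero≡) (s≤s z≤n)
... | zero with Σℕ>0⇒>0 n (λ i → f (suc i)) Σf>0
...   | j , fj>0 = suc j , fj>0

Σℕ-pick : ∀ n (f : Fin n → ℕ) j → Σℕ n (λ i → ind (does (i ≟ᶠ j)) (f i)) ≡ f j
Σℕ-pick (suc n) f zero    = trans (cong (f zero +_) (Σℕ-0 n (λ _ → refl))) (ℕP.+-identityʳ _)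
Σℕ-pick (suc n) f (suc j) = Σℕ-pick n (λ i → f (suc i)) j

Σℕ-pick′ : ∀ n (f : Fin n → ℕ) j → Σℕ n (λ i → ind (does (j ≟ᶠ i)) (f i)) ≡ f j
Σℕ-pick′ n f j = trans (Σℕ-cong n (λ i → cong (λ b → ind b (f i)) (does-sym j i))) (Σℕ-pick n f j)

Σℕ-∸ : ∀ n (f d : Fin n → ℕ) → (∀ i → d i ≤ f i) →
  Σℕ n (λ i → f i ∸ d i) + Σℕ n d ≡ Σℕ n f
Σℕ-∸ n f d d≤f = trans (sym (Σℕ-+ n (λ i → f i ∸ d i) d)) (Σℕ-cong n (λ i → ℕP.m∸n+n≡m (d≤f i)))

Σℕ≤1⇒ : ∀ n (f : Fin n → ℕ) → Σℕ n f ≤ 1 →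
  (∀ i → f i ≡ 0) ⊎ (∃[ j ] ∀ i → f i ≡ ind (does (i ≟ᶠ j)) 1)
Σℕ≤1⇒ zero    f _ = inj₁ (λ ())
Σℕ≤1⇒ (suc n) f Σf≤1 with f zero in fzero≡
... | zero with Σℕ≤1⇒ n (λ i → f (suc i)) Σf≤1
...   | inj₁ f≗0     = inj₁ λ { zero → fzero≡ ; (suc i) → f≗0 i }
...   | inj₂ (j , f≗) = inj₂ (suc j , λ { zero → fzero≡ ; (suc i) → f≗ i })
Σℕ≤1⇒ (suc n) f (s≤s Σf≤0) | suc zero =
  inj₂ (zero , λ { zero → fzero≡ ; (suc i) → Σℕ≡0⇒≡0 n (λ i → f (suc i)) (ℕP.n≤0⇒n≡0 Σf≤0) i })
Σℕ≤1⇒ (suc n) f (s≤s ()) | suc (suc _)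

Σℤ-ind : ∀ n (b : Fin n → Bool) (f : Fin n → ℕ) →
  Σℤ n (λ i → if b i then ℤ.+ f i else ℤ.+ 0) ≡ ℤ.+ Σℕ n (λ i → ind (b i) (f i))
Σℤ-ind zero    b f = refl
Σℤ-ind (suc n) b f =
  trans (cong₂ ℤ._+_ (ifpos (b zero)) (Σℤ-ind n (λ i → b (suc i)) (λ i → f (suc i))))
        (sym (ℤP.pos-+ (ind (b zero) (f zero)) _))
  where
  ifpos : ∀ c → (if c then ℤ.+ f zero else ℤ.+ 0) ≡ ℤ.+ ind c (f zero)
  ifpos true  = refl
  ifpos false = refl

-≡-⇔+≡+ : ∀ (i j k l : ℤ) → (i ℤ.- j ≡ k ℤ.- l) ⇔ (i ℤ.+ l ≡ k ℤ.+ j)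
-≡-⇔+≡+ i j k l = mk⇔
  (λ eq → trans (move i j l) (trans (cong (ℤ._+ (j ℤ.+ l)) eq) (cancel k l j)))
  (λ eq → trans (extend i j l) (trans (cong (ℤ._- (j ℤ.+ l)) eq) (retract k j l)))
  where
  move : ∀ i j l → i ℤ.+ l ≡ (i ℤ.- j) ℤ.+ (j ℤ.+ l)
  move = ℤ-Solver.solve-∀
  cancel : ∀ k l j → (k ℤ.- l) ℤ.+ (j ℤ.+ l) ≡ k ℤ.+ j
  cancel = ℤ-Solver.solve-∀
  extend : ∀ i j l → i ℤ.- j ≡ (i ℤ.+ l) ℤ.- (j ℤ.+ l)
  extend = ℤ-Solver.solve-∀
  retract : ∀ k j l → (k ℤ.+ j) ℤ.- (j ℤ.+ l) ≡ k ℤ.- l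
  retract = ℤ-Solver.solve-∀

pos-−-≡⇔+≡+ : ∀ a b c d → (ℤ.+ a ℤ.- ℤ.+ b ≡ ℤ.+ c ℤ.- ℤ.+ d) ⇔ (a + d ≡ c + b)
pos-−-≡⇔+≡+ a b c d = mk⇔
  (λ eq → ℤP.+-injective (trans (ℤP.pos-+ a d) (trans (Equivalence.to inℤ eq) (sym (ℤP.pos-+ c b)))))
  (λ eq → Equivalence.from inℤ (trans (sym (ℤP.pos-+ a d)) (trans (cong ℤ.+_ eq) (ℤP.pos-+ c b))))
  where
  inℤ : (ℤ.+ a ℤ.- ℤ.+ b ≡ ℤ.+ c ℤ.- ℤ.+ d) ⇔ (ℤ.+ a ℤ.+ ℤ.+ d ≡ ℤ.+ c ℤ.+ ℤ.+ b)
  inℤ = -≡-⇔+≡+ (ℤ.+ a) (ℤ.+ b) (ℤ.+ c) (ℤ.+ d)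

pos-≡-−⇔+≡ : ∀ a b c → (ℤ.+ a ≡ ℤ.+ c ℤ.- ℤ.+ b) ⇔ (a + b ≡ c)
pos-≡-−⇔+≡ a b c = mk⇔
  (λ eq → trans (Equivalence.to (pos-−-≡⇔+≡+ a 0 c b) (trans (ℤP.+-identityʳ (ℤ.+ a)) eq))
                (ℕP.+-identityʳ c))
  (λ eq → trans (sym (ℤP.+-identityʳ (ℤ.+ a)))
                (Equivalence.from (pos-−-≡⇔+≡+ a 0 c b) (trans eq (sym (ℕP.+-identityʳ c)))))

ℕtoℚ≡mkℚ : ∀ n → ℕtoℚ n ≡ mkℚ (ℤ.+ n) 0 (coprime-sym (1-coprimeTo n))
ℕtoℚ≡mkℚ n = ℚP.↥p/↧p≡p (mkℚ (ℤ.+ n) 0 (coprime-sym (1-coprimeTo n)))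

ℕtoℚ-mono-≤ : ∀ {m n} → m ≤ n → ℕtoℚ m ℚ.≤ ℕtoℚ n
ℕtoℚ-mono-≤ {m} {n} m≤n rewrite ℕtoℚ≡mkℚ m | ℕtoℚ≡mkℚ n =
  ℚ.*≤* (ℤP.*-monoʳ-≤-nonNeg (ℤ.+ 1) (ℤ.+≤+ m≤n))

count : ∀ {X : Set} {P : X → Set} → Decidable P → List X → ℕ
count P? xs = List.length (List.filter P? xs)

module _ {X : Set} {P Q : X → Set} (P? : Decidable P) (Q? : Decidable Q) (Q⇒P : ∀ {x} → Q x → P x) where

  count-mono-≤ : ∀ xs → count Q? xs ≤ count P? xs
  count-mono-≤ []       = z≤n
  count-mono-≤ (x ∷ xs) with Q? x | P? x
  ... | yes _  | yes _  = s≤s (count-mono-≤ xs)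
  ... | yes qx | no ¬px = ⊥-elim (¬px (Q⇒P qx))
  ... | no _   | yes _  = ℕP.m≤n⇒m≤1+n (count-mono-≤ xs)
  ... | no _   | no _   = count-mono-≤ xs

  count-mono-< : ∀ {x xs} → x ∈ xs → P x → ¬ Q x → count Q? xs < count P? xs
  count-mono-< {x} {x ∷ xs} (here refl) px ¬qx with Q? x | P? x
  ... | yes qx | _      = ⊥-elim (¬qx qx)
  ... | no _   | yes _  = s≤s (count-mono-≤ xs)
  ... | no _   | no ¬px = ⊥-elim (¬px px)
  count-mono-< {xs = y ∷ xs} (there x∈xs) px ¬qx with Q? y | P? y
  ... | yes _  | yes _  = s≤s (count-mono-< x∈xs px ¬qx)
  ... | yes qy | no ¬py = ⊥-elim (¬py (Q⇒P qy))
  ... | no _   | yes _  = ℕP.m≤n⇒m≤1+n (count-mono-< x∈xs px ¬qx)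
  ... | no _   | no _   = count-mono-< x∈xs px ¬qx

-- Configurations, guards and contexts

module _ (A : TA) where
  open TA A

  src tgt : Fin nR → Fin nL
  src r = from (rules r)
  tgt r = to (rules r)

  guards : Fin nR → List (Guard nG nP)
  guards r = φ (rules r)

  inc : Fin nR → Fin nG → ℕ
  inc r z = bit (u (rules r) z)

  infix 4 _≋_ _≼_ _⊨ᵍ_

  _≋_ : Config A → Config A → Set
  _≋_ = _≈_ A

  _⊨ᵍ_ : Config A → Guard nG nP → Set
  _⊨ᵍ_ = _⊨g_ A

  ≋-refl : ∀ {σ} → σ ≋ σ
  ≋-refl = (λ _ → refl) , (λ _ → refl) , (λ _ → refl)

  ≋-sym : ∀ {σ ρ} → σ ≋ ρ → ρ ≋ σ
  ≋-sym (κ≡ , g≡ , p≡) = (λ ℓ → sym (κ≡ ℓ)) , (λ z → sym (g≡ z)) , (λ i → sym (p≡ i))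

  ≋-trans : ∀ {σ ρ θ} → σ ≋ ρ → ρ ≋ θ → σ ≋ θ
  ≋-trans (κ≡ , g≡ , p≡) (κ≡′ , g≡′ , p≡′) =
    (λ ℓ → trans (κ≡ ℓ) (κ≡′ ℓ)) , (λ z → trans (g≡ z) (g≡′ z)) , (λ i → trans (p≡ i) (p≡′ i))

  record _≼_ (σ ρ : Config A) : Set where
    constructor _,_
    field
      gv-≤ : ∀ z → gv σ z ≤ gv ρ z
      pv-≡ : ∀ i → pv σ i ≡ pv ρ i
  open _≼_

  ≼-refl : ∀ {σ} → σ ≼ σ
  ≼-refl = (λ _ → ℕP.≤-refl) , (λ _ → refl)

  ≼-trans : ∀ {σ ρ θ} → σ ≼ ρ → ρ ≼ θ → σ ≼ θ
  ≼-trans (g≤ , p≡) (g≤′ , p≡′) = (λ z → ℕP.≤-trans (g≤ z) (g≤′ z)) , (λ i → trans (p≡ i) (p≡′ i))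

  ≋⇒≼ : ∀ {σ ρ} → σ ≋ ρ → σ ≼ ρ
  ≋⇒≼ (_ , g≡ , p≡) = (λ z → ℕP.≤-reflexive (g≡ z)) , p≡

  kind-cases : ∀ (g : Guard nG nP) → kind g ≡ rise ⊎ kind g ≡ fall
  kind-cases g with kind g
  ... | rise = inj₁ refl
  ... | fall = inj₂ refl

  rise≢fall : ∀ {g : Guard nG nP} → kind g ≡ rise → kind g ≡ fall → ⊥
  rise≢fall k≡rise k≡fall with trans (sym k≡rise) k≡fall
  ... | ()

  bound-cong : ∀ g {p q : Fin nP → ℕ} → (∀ i → p i ≡ q i) → bound A g p ≡ bound A g q
  bound-cong g p≗q =
    cong (a₀ g ℚ.+_) (Σℚ-cong nP (λ i → cong (λ w → Vec.lookup (coeff g) i ℚ.* ℕtoℚ w) (p≗q i)))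
    where
    Σℚ-cong : ∀ n {f g : Fin n → ℚ.ℚ} → (∀ i → f i ≡ g i) → Σℚ n f ≡ Σℚ n g
    Σℚ-cong zero    f≗g = refl
    Σℚ-cong (suc n) f≗g = cong₂ ℚ._+_ (f≗g zero) (Σℚ-cong n (λ i → f≗g (suc i)))

  rise-⊨-mono : ∀ g {σ ρ} → kind g ≡ rise → σ ≼ ρ → σ ⊨ᵍ g → ρ ⊨ᵍ g
  rise-⊨-mono g {σ} {ρ} k σ≼ρ σ⊨g with kind g
  rise-⊨-mono g {σ} {ρ} refl (g≤ , p≡) σ⊨g | rise =
    subst (ℚ._≤ ℕtoℚ (gv ρ (var g))) (bound-cong g p≡) (ℚP.≤-trans σ⊨g (ℕtoℚ-mono-≤ (g≤ (var g))))

  fall-⊨-antimono : ∀ g {σ ρ} → kind g ≡ fall → ρ ≼ σ → σ ⊨ᵍ g → ρ ⊨ᵍ g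
  fall-⊨-antimono g {σ} {ρ} k ρ≼σ σ⊨g with kind g
  fall-⊨-antimono g {σ} {ρ} refl (g≤ , p≡) σ⊨g | fall =
    subst (ℕtoℚ (gv ρ (var g)) ℚ.<_) (sym (bound-cong g p≡)) (ℚP.≤-<-trans (ℕtoℚ-mono-≤ (g≤ (var g))) σ⊨g)

  ⊨ᵍ-cong : ∀ g {σ ρ} → σ ≼ ρ → ρ ≼ σ → σ ⊨ᵍ g → ρ ⊨ᵍ g
  ⊨ᵍ-cong g σ≼ρ ρ≼σ with kind-cases g
  ... | inj₁ k = rise-⊨-mono g k σ≼ρ
  ... | inj₂ k = fall-⊨-antimono g k ρ≼σ

  ⊨-map : ∀ gs {σ ρ} → (∀ {g} → g ∈ gs → σ ⊨ᵍ g → ρ ⊨ᵍ g) → _⊨_ A σ gs → _⊨_ A ρ gs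
  ⊨-map []       f _             = tt
  ⊨-map (g ∷ gs) f (σ⊨g , σ⊨gs) = f (here refl) σ⊨g , ⊨-map gs (f ∘ there) σ⊨gs

  ⊨-cong : ∀ gs {σ ρ} → σ ≼ ρ → ρ ≼ σ → _⊨_ A σ gs → _⊨_ A ρ gs
  ⊨-cong gs σ≼ρ ρ≼σ = ⊨-map gs (λ {g} _ → ⊨ᵍ-cong g σ≼ρ ρ≼σ)

  _⊨ᵍ?_ : ∀ σ g → Dec (σ ⊨ᵍ g)
  σ ⊨ᵍ? g with kind g
  ... | rise = bound A g (pv σ) ℚP.≤? ℕtoℚ (gv σ (var g))
  ... | fall = ℕtoℚ (gv σ (var g)) ℚP.<? bound A g (pv σ)

  -- ω A σ g is g ∈ Φ A × InContext σ g.
  InContext : Config A → Guard nG nP → Set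
  InContext σ g = (kind g ≡ rise × σ ⊨ᵍ g) ⊎ (kind g ≡ fall × ¬ σ ⊨ᵍ g)

  InContext-mono : ∀ {σ ρ} g → σ ≼ ρ → InContext σ g → InContext ρ g
  InContext-mono g σ≼ρ (inj₁ (k , σ⊨g))  = inj₁ (k , rise-⊨-mono g k σ≼ρ σ⊨g)
  InContext-mono g σ≼ρ (inj₂ (k , σ⊭g)) = inj₂ (k , λ ρ⊨g → σ⊭g (fall-⊨-antimono g k σ≼ρ ρ⊨g))

  InContext? : ∀ σ g → Dec (InContext σ g)
  InContext? σ g with kind-cases g | σ ⊨ᵍ? g
  ... | inj₁ k | yes σ⊨g = yes (inj₁ (k , σ⊨g))
  ... | inj₁ k | no  σ⊭g = no λ { (inj₁ (_ , σ⊨g)) → σ⊭g σ⊨g ; (inj₂ (k′ , _)) → rise≢fall {g} k k′ }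
  ... | inj₂ k | yes σ⊨g = no λ { (inj₁ (k′ , _)) → rise≢fall {g} k′ k ; (inj₂ (_ , σ⊭g)) → σ⊭g σ⊨g }
  ... | inj₂ k | no  σ⊭g = yes (inj₂ (k , σ⊭g))

  guard∈Φ : ∀ r {g} → g ∈ guards r → g ∈ Φ A
  guard∈Φ r g∈ = ∈-concatMap⁺ guards (Any.map (λ { refl → g∈ }) (∈-allFin r))

  sameContext : ∀ {σ ρ} → (∀ g → InContext σ g → InContext ρ g) →
    (∀ g → g ∈ Φ A → InContext ρ g → InContext σ g) → SameContext A σ ρ
  sameContext forth back g = mk⇔ (λ { (g∈ , c) → g∈ , forth g c }) (λ { (g∈ , c) → g∈ , back g g∈ c })

  sameContext-refl : ∀ {σ} → SameContext A σ σ
  sameContext-refl = sameContext (λ _ c → c) (λ _ _ c → c)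

  sameContext-trans : ∀ {σ ρ θ} → SameContext A σ ρ → SameContext A ρ θ → SameContext A σ θ
  sameContext-trans σ~ρ ρ~θ g = mk⇔ (Equivalence.to (ρ~θ g) ∘ Equivalence.to (σ~ρ g))
                                     (Equivalence.from (σ~ρ g) ∘ Equivalence.from (ρ~θ g))

  ≋⇒sameContext : ∀ {σ ρ} → σ ≋ ρ → SameContext A σ ρ
  ≋⇒sameContext σ≋ρ = sameContext (λ g → InContext-mono g (≋⇒≼ σ≋ρ))
                                  (λ g _ → InContext-mono g (≋⇒≼ (≋-sym σ≋ρ)))

  -- Rule occurrences and runs

  unit : Fin nR → RuleVec A
  unit x r = ind (does (r ≟ᶠ x)) 1

  infixl 6 _⊕_

  _⊕_ : RuleVec A → RuleVec A → RuleVec A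
  (X ⊕ Y) r = X r + Y r

  occ-∷ : ∀ x τ r → occ A (x ∷ τ) r ≡ (unit x ⊕ occ A τ) r
  occ-∷ x τ r with does (r ≟ᶠ x)
  ... | true  = refl
  ... | false = refl

  occ-++ : ∀ τ τ′ r → occ A (τ ++ τ′) r ≡ occ A τ r + occ A τ′ r
  occ-++ []      τ′ r = refl
  occ-++ (x ∷ τ) τ′ r = begin
    occ A (x ∷ τ ++ τ′) r                  ≡⟨ occ-∷ x (τ ++ τ′) r ⟩
    unit x r + occ A (τ ++ τ′) r           ≡⟨ cong (unit x r +_) (occ-++ τ τ′ r) ⟩
    unit x r + (occ A τ r + occ A τ′ r)    ≡⟨ ℕP.+-assoc (unit x r) _ _ ⟨
    (unit x r + occ A τ r) + occ A τ′ r    ≡⟨ cong (_+ occ A τ′ r) (occ-∷ x τ r) ⟨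
    occ A (x ∷ τ) r + occ A τ′ r           ∎
    where open ≡-Reasoning

  occ-∷-self : ∀ r τ → occ A (r ∷ τ) r ≡ suc (occ A τ r)
  occ-∷-self r τ = trans (occ-∷ r τ r) (cong (λ b → ind b 1 + occ A τ r) (does-refl r))

  occ-∷-other : ∀ x τ r → r ≢ x → occ A (x ∷ τ) r ≡ occ A τ r
  occ-∷-other x τ r r≢x = trans (occ-∷ x τ r) (cong (λ b → ind b 1 + occ A τ r) (does-≢ r≢x))

  occ-≤-∷ : ∀ x τ r → occ A τ r ≤ occ A (x ∷ τ) r
  occ-≤-∷ x τ r = subst (occ A τ r ≤_) (sym (occ-∷ x τ r)) (ℕP.m≤n+m _ _)

  occ>0-∷ : ∀ x τ r → 0 < occ A τ r → 0 < occ A (x ∷ τ) r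
  occ>0-∷ x τ r occ>0 = ℕP.<-≤-trans occ>0 (occ-≤-∷ x τ r)

  occ>0⇒∈ : ∀ τ r → 0 < occ A τ r → r ∈ τ
  occ>0⇒∈ (x ∷ τ) r occ>0 with x ≟ᶠ r
  ... | yes refl = here refl
  ... | no  x≢r  = there (occ>0⇒∈ τ r (subst (0 <_) (occ-∷-other x τ r (x≢r ∘ sym)) occ>0))

  ∈⇒occ>0 : ∀ τ r → r ∈ τ → 0 < occ A τ r
  ∈⇒occ>0 (x ∷ τ) r (here refl)  = subst (0 <_) (sym (occ-∷-self r τ)) (s≤s z≤n)
  ∈⇒occ>0 (x ∷ τ) r (there r∈τ) = occ>0-∷ x τ r (∈⇒occ>0 τ r r∈τ)

  Σℕ-occ-∷ : ∀ x τ → Σℕ nR (occ A (x ∷ τ)) ≡ suc (Σℕ nR (occ A τ))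
  Σℕ-occ-∷ x τ = trans (Σℕ-cong nR (occ-∷ x τ))
    (trans (Σℕ-+ nR (unit x) (occ A τ)) (cong (_+ Σℕ nR (occ A τ)) (Σℕ-pick nR (λ _ → 1) x)))

  apply-≋ : ∀ r {σ ρ} → σ ≋ ρ → apply A r σ ≋ apply A r ρ
  apply-≋ r (κ≡ , g≡ , p≡) =
    (λ ℓ → cong (λ k → (k ∸ δ A (src r) ℓ) + δ A (tgt r) ℓ) (κ≡ ℓ)) , (λ z → cong (_+ inc r z) (g≡ z)) , p≡

  Enabled-≋ : ∀ r {σ ρ} → σ ≋ ρ → Enabled A σ r → Enabled A ρ r
  Enabled-≋ r σ≋ρ@(κ≡ , _ , _) (occupied , σ⊨φ) =
    subst (0 <_) (κ≡ (src r)) occupied , ⊨-cong (guards r) (≋⇒≼ σ≋ρ) (≋⇒≼ (≋-sym σ≋ρ)) σ⊨φ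

  Run-≋ˡ : ∀ {σ ρ τ θ} → σ ≋ ρ → Run A σ τ θ → Run A ρ τ θ
  Run-≋ˡ σ≋ρ (done σ≋θ)                = done (≋-trans (≋-sym σ≋ρ) σ≋θ)
  Run-≋ˡ σ≋ρ (step {r = r} enabled run) = step (Enabled-≋ r σ≋ρ enabled) (Run-≋ˡ (apply-≋ r σ≋ρ) run)

  Run-≋ʳ : ∀ {σ τ θ θ′} → Run A σ τ θ → θ ≋ θ′ → Run A σ τ θ′
  Run-≋ʳ (done σ≋θ)       θ≋θ′ = done (≋-trans σ≋θ θ≋θ′)
  Run-≋ʳ (step enabled run) θ≋θ′ = step enabled (Run-≋ʳ run θ≋θ′)

  Run-++ : ∀ {σ ρ θ τ τ′} → Run A σ τ ρ → Run A ρ τ′ θ → Run A σ (τ ++ τ′) θ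
  Run-++ (done σ≋ρ)         run′ = Run-≋ˡ (≋-sym σ≋ρ) run′
  Run-++ (step enabled run) run′ = step enabled (Run-++ run run′)

  ≼-apply : ∀ r σ → σ ≼ apply A r σ
  ≼-apply r σ = (λ z → ℕP.m≤m+n (gv σ z) (inc r z)) , (λ _ → refl)

  Run⇒≼ : ∀ {σ τ θ} → Run A σ τ θ → σ ≼ θ
  Run⇒≼ (done σ≋θ)                    = ≋⇒≼ σ≋θ
  Run⇒≼ {σ} (step {r = r} _ run) = ≼-trans (≼-apply r σ) (Run⇒≼ run)

  IsConfig-apply : ∀ σ r → IsConfig A σ → Enabled A σ r → IsConfig A (apply A r σ)
  IsConfig-apply σ r (rc , N≡) (occupied , _) = rc , trans (cong ℤ.+_ Σκ-preserved) N≡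
    where
    open ≡-Reasoning
    Σκ-preserved : Σℕ nL (κ (apply A r σ)) ≡ Σℕ nL (κ σ)
    Σκ-preserved = begin
      Σℕ nL (λ ℓ → (κ σ ℓ ∸ δ A (src r) ℓ) + δ A (tgt r) ℓ)
        ≡⟨ Σℕ-+ nL (λ ℓ → κ σ ℓ ∸ δ A (src r) ℓ) (δ A (tgt r)) ⟩
      Σℕ nL (λ ℓ → κ σ ℓ ∸ δ A (src r) ℓ) + Σℕ nL (δ A (tgt r))
        ≡⟨ cong (Σℕ nL (λ ℓ → κ σ ℓ ∸ δ A (src r) ℓ) +_)
                (trans (Σℕ-pick′ nL (λ _ → 1) (tgt r)) (sym (Σℕ-pick′ nL (λ _ → 1) (src r)))) ⟩
      Σℕ nL (λ ℓ → κ σ ℓ ∸ δ A (src r) ℓ) + Σℕ nL (δ A (src r))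
        ≡⟨ Σℕ-∸ nL (κ σ) (δ A (src r)) (ind-≟-≤ (κ σ) (src r) occupied) ⟩
      Σℕ nL (κ σ) ∎

  infixr 5 _◅_

  data Path (X : RuleVec A) : Fin nL → Fin nR → Set where
    [_] : ∀ {r} → 0 < X r → Path X (src r) r
    _◅_ : ∀ {r r′} → 0 < X r′ → Path X (tgt r′) r → Path X (src r′) r

  Path-mono : ∀ {X Y ℓ r} → (∀ r → 0 < X r → 0 < Y r) → Path X ℓ r → Path Y ℓ r
  Path-mono X⇒Y [ Xr>0 ]       = [ X⇒Y _ Xr>0 ]
  Path-mono X⇒Y (Xr>0 ◅ path) = X⇒Y _ Xr>0 ◅ Path-mono X⇒Y path

  SupportReachable : Config A → RuleVec A → Set
  SupportReachable σ X = ∀ r → 0 < X r → ∃[ ℓ ] (0 < κ σ ℓ × Path X ℓ r)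

  Chain : RuleVec A → Fin nL → Fin nR → Set
  Chain X ℓ r = ∃[ s ] Σ (Fin (suc s) → Fin nR) λ rs →
    (∀ i → 0 < X (rs i)) × src (rs zero) ≡ ℓ
    × (∀ (i : Fin s) → tgt (rs (inject₁ i)) ≡ src (rs (suc i))) × rs (fromℕ s) ≡ r

  Path⇒Chain : ∀ {X ℓ r} → Path X ℓ r → Chain X ℓ r
  Path⇒Chain {r = r} [ Xr>0 ] = 0 , (λ _ → r) , (λ _ → Xr>0) , refl , (λ ()) , refl
  Path⇒Chain (_◅_ {r′ = r′} Xr′>0 path) with Path⇒Chain path
  ... | s , rs , pos , first , linked , last =
    suc s , (λ { zero → r′ ; (suc i) → rs i }) , (λ { zero → Xr′>0 ; (suc i) → pos i }) , refl ,
    (λ { zero → sym first ; (suc i) → linked i }) , last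

  Chain⇒Path : ∀ {X} s (rs : Fin (suc s) → Fin nR) → (∀ i → 0 < X (rs i)) →
    (∀ (i : Fin s) → tgt (rs (inject₁ i)) ≡ src (rs (suc i))) → Path X (src (rs zero)) (rs (fromℕ s))
  Chain⇒Path zero    rs pos linked = [ pos zero ]
  Chain⇒Path {X} (suc s) rs pos linked =
    pos zero ◅ subst (λ ℓ → Path X ℓ (rs (fromℕ (suc s)))) (sym (linked zero))
                     (Chain⇒Path s (λ i → rs (suc i)) (λ i → pos (suc i)) (λ i → linked (suc i)))

  CondAppl⇔SupportReachable : ∀ σ X → CondAppl A σ X ⇔ SupportReachable σ X
  CondAppl⇔SupportReachable σ X = mk⇔ condAppl⇒ ⇒condAppl
    where
    condAppl⇒ : CondAppl A σ X → SupportReachable σ X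
    condAppl⇒ condAppl r Xr>0 with condAppl r Xr>0
    ... | s , rs , pos , occupied , linked , refl = src (rs zero) , occupied , Chain⇒Path s rs pos linked
    ⇒condAppl : SupportReachable σ X → CondAppl A σ X
    ⇒condAppl reachable r Xr>0 with reachable r Xr>0
    ... | ℓ , occupied , path with Path⇒Chain path
    ...   | s , rs , pos , refl , linked , last = s , rs , pos , occupied , linked , last

  -- Flow equations

  flow : (Fin nR → Fin nL) → RuleVec A → Fin nL → ℕ
  flow end X ℓ = Σℕ nR (λ r → ind (does (end r ≟ᶠ ℓ)) (X r))

  flow-cong : ∀ end {X Y} → (∀ r → X r ≡ Y r) → ∀ ℓ → flow end X ℓ ≡ flow end Y ℓ
  flow-cong end X≗Y ℓ = Σℕ-cong nR (λ r → cong (ind (does (end r ≟ᶠ ℓ))) (X≗Y r))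

  flow-⊕ : ∀ end X Y ℓ → flow end (X ⊕ Y) ℓ ≡ flow end X ℓ + flow end Y ℓ
  flow-⊕ end X Y ℓ = trans (Σℕ-cong nR (λ r → ind-+ (does (end r ≟ᶠ ℓ)) (X r) (Y r))) (Σℕ-+ nR _ _)

  flow-unit : ∀ end x ℓ → flow end (unit x) ℓ ≡ δ A (end x) ℓ
  flow-unit end x ℓ = trans (Σℕ-cong nR (λ r → ind-comm (does (end r ≟ᶠ ℓ)) (does (r ≟ᶠ x)) 1))
                            (Σℕ-pick nR (λ r → δ A (end r) ℓ) x)

  flow-0 : ∀ end {X} → (∀ r → X r ≡ 0) → ∀ ℓ → flow end X ℓ ≡ 0
  flow-0 end X≗0 ℓ = Σℕ-0 nR (λ r → trans (cong (ind (does (end r ≟ᶠ ℓ))) (X≗0 r)) (ind-0 _))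

  flow-mono-≤ : ∀ end {X Y} ℓ → (∀ r → end r ≡ ℓ → X r ≤ Y r) → flow end X ℓ ≤ flow end Y ℓ
  flow-mono-≤ end {X} {Y} ℓ X≤Y = Σℕ-mono-≤ nR pointwise
    where
    pointwise : ∀ r → ind (does (end r ≟ᶠ ℓ)) (X r) ≤ ind (does (end r ≟ᶠ ℓ)) (Y r)
    pointwise r with end r ≟ᶠ ℓ
    ... | yes end≡ℓ = X≤Y r end≡ℓ
    ... | no  _     = z≤n

  Balanced : RuleVec A → (Fin nL → ℕ) → (Fin nL → ℕ) → Set
  Balanced X a c = ∀ ℓ → flow tgt X ℓ + a ℓ ≡ flow src X ℓ + c ℓ

  Balanced-cong : ∀ {X Y a c} → (∀ r → X r ≡ Y r) → Balanced X a c → Balanced Y a c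
  Balanced-cong {a = a} {c} X≗Y bal ℓ =
    trans (cong (_+ a ℓ) (sym (flow-cong tgt X≗Y ℓ))) (trans (bal ℓ) (cong (_+ c ℓ) (flow-cong src X≗Y ℓ)))

  Balanced-congʳ : ∀ {X a c c′} → (∀ ℓ → c ℓ ≡ c′ ℓ) → Balanced X a c → Balanced X a c′
  Balanced-congʳ {X} c≗c′ balanced ℓ = trans (balanced ℓ) (cong (flow src X ℓ +_) (c≗c′ ℓ))

  Balanced-0 : ∀ {X a c} → (∀ r → X r ≡ 0) → (∀ ℓ → a ℓ ≡ c ℓ) → Balanced X a c
  Balanced-0 {a = a} {c} X≗0 a≗c ℓ =
    trans (cong (_+ a ℓ) (flow-0 tgt X≗0 ℓ)) (trans (a≗c ℓ) (cong (_+ c ℓ) (sym (flow-0 src X≗0 ℓ))))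

  Balanced-0⁻¹ : ∀ {X a c} → (∀ r → X r ≡ 0) → Balanced X a c → ∀ ℓ → a ℓ ≡ c ℓ
  Balanced-0⁻¹ {a = a} {c} X≗0 bal ℓ =
    trans (cong (_+ a ℓ) (sym (flow-0 tgt X≗0 ℓ))) (trans (bal ℓ) (cong (_+ c ℓ) (flow-0 src X≗0 ℓ)))

  Balanced-unit : ∀ x {a c} → (∀ ℓ → δ A (tgt x) ℓ + a ℓ ≡ δ A (src x) ℓ + c ℓ) → Balanced (unit x) a c
  Balanced-unit x {a} {c} moved ℓ =
    trans (cong (_+ a ℓ) (flow-unit tgt x ℓ)) (trans (moved ℓ) (cong (_+ c ℓ) (sym (flow-unit src x ℓ))))

  Balanced-⊕ : ∀ {X Y a b c} → Balanced X a b → Balanced Y b c → Balanced (X ⊕ Y) a c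
  Balanced-⊕ {X} {Y} {a} {b} {c} balX balY ℓ = begin
    flow tgt (X ⊕ Y) ℓ + a ℓ                    ≡⟨ cong (_+ a ℓ) (flow-⊕ tgt X Y ℓ) ⟩
    (flow tgt X ℓ + flow tgt Y ℓ) + a ℓ         ≡⟨ swap (flow tgt X ℓ) (flow tgt Y ℓ) (a ℓ) ⟩
    flow tgt Y ℓ + (flow tgt X ℓ + a ℓ)         ≡⟨ cong (flow tgt Y ℓ +_) (balX ℓ) ⟩
    flow tgt Y ℓ + (flow src X ℓ + b ℓ)         ≡⟨ swap′ (flow tgt Y ℓ) (flow src X ℓ) (b ℓ) ⟩
    flow src X ℓ + (flow tgt Y ℓ + b ℓ)         ≡⟨ cong (flow src X ℓ +_) (balY ℓ) ⟩
    flow src X ℓ + (flow src Y ℓ + c ℓ)         ≡⟨ ℕP.+-assoc (flow src X ℓ) (flow src Y ℓ) (c ℓ) ⟨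
    (flow src X ℓ + flow src Y ℓ) + c ℓ         ≡⟨ cong (_+ c ℓ) (flow-⊕ src X Y ℓ) ⟨
    flow src (X ⊕ Y) ℓ + c ℓ                    ∎
    where
    open ≡-Reasoning
    swap : ∀ x y z → (x + y) + z ≡ y + (x + z)
    swap = solve-∀
    swap′ : ∀ x y z → x + (y + z) ≡ y + (x + z)
    swap′ = solve-∀

  Balanced-cancelʳ : ∀ {X Y a b c} → Balanced (X ⊕ Y) a c → Balanced Y b c → Balanced X a b
  Balanced-cancelʳ {X} {Y} {a} {b} {c} balXY balY ℓ = ℕP.+-cancelʳ-≡ (flow tgt Y ℓ) _ _ (begin
    (flow tgt X ℓ + a ℓ) + flow tgt Y ℓ         ≡⟨ swap (flow tgt X ℓ) (a ℓ) (flow tgt Y ℓ) ⟩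
    (flow tgt X ℓ + flow tgt Y ℓ) + a ℓ         ≡⟨ cong (_+ a ℓ) (flow-⊕ tgt X Y ℓ) ⟨
    flow tgt (X ⊕ Y) ℓ + a ℓ                    ≡⟨ balXY ℓ ⟩
    flow src (X ⊕ Y) ℓ + c ℓ                    ≡⟨ cong (_+ c ℓ) (flow-⊕ src X Y ℓ) ⟩
    (flow src X ℓ + flow src Y ℓ) + c ℓ         ≡⟨ ℕP.+-assoc (flow src X ℓ) (flow src Y ℓ) (c ℓ) ⟩
    flow src X ℓ + (flow src Y ℓ + c ℓ)         ≡⟨ cong (flow src X ℓ +_) (balY ℓ) ⟨
    flow src X ℓ + (flow tgt Y ℓ + b ℓ)         ≡⟨ swap′ (flow src X ℓ) (flow tgt Y ℓ) (b ℓ) ⟩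
    (flow src X ℓ + b ℓ) + flow tgt Y ℓ         ∎)
    where
    open ≡-Reasoning
    swap : ∀ x y z → (x + y) + z ≡ (x + z) + y
    swap = solve-∀
    swap′ : ∀ x y z → x + (y + z) ≡ (x + z) + y
    swap′ = solve-∀

  CondL⇔Balanced : ∀ σ σ′ X → CondL A σ σ′ X ⇔ Balanced X (κ σ) (κ σ′)
  CondL⇔Balanced σ σ′ X = mk⇔
    (λ condL ℓ → trans (Equivalence.to (pos-−-≡⇔+≡+ (inflow ℓ) (outflow ℓ) (κ σ′ ℓ) (κ σ ℓ)) (trans (sym (asℕ ℓ)) (condL ℓ)))
                       (ℕP.+-comm (κ σ′ ℓ) (outflow ℓ)))
    (λ balanced ℓ → trans (asℕ ℓ) (Equivalence.from (pos-−-≡⇔+≡+ (inflow ℓ) (outflow ℓ) (κ σ′ ℓ) (κ σ ℓ))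
                                    (trans (balanced ℓ) (ℕP.+-comm (outflow ℓ) (κ σ′ ℓ)))))
    where
    inflow outflow : Fin nL → ℕ
    inflow  = flow tgt X
    outflow = flow src X
    asℕ : ∀ ℓ → Σℤ nR (λ r → if does (tgt r ≟ᶠ ℓ) then ℤ.+ X r else ℤ.+ 0)
                 ℤ.- Σℤ nR (λ r → if does (src r ≟ᶠ ℓ) then ℤ.+ X r else ℤ.+ 0)
               ≡ ℤ.+ inflow ℓ ℤ.- ℤ.+ outflow ℓ
    asℕ ℓ = cong₂ ℤ._-_ (Σℤ-ind nR (λ r → does (tgt r ≟ᶠ ℓ)) X) (Σℤ-ind nR (λ r → does (src r ≟ᶠ ℓ)) X)

  apply-Balanced : ∀ r σ → 0 < κ σ (src r) → Balanced (unit r) (κ σ) (κ (apply A r σ))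
  apply-Balanced r σ occupied = Balanced-unit r moved
    where
    moved : ∀ ℓ → δ A (tgt r) ℓ + κ σ ℓ ≡ δ A (src r) ℓ + κ (apply A r σ) ℓ
    moved ℓ = begin
      δ A (tgt r) ℓ + κ σ ℓ                                   ≡⟨ cong (δ A (tgt r) ℓ +_) (ℕP.m∸n+n≡m (ind-≟-≤ (κ σ) (src r) occupied ℓ)) ⟨
      δ A (tgt r) ℓ + ((κ σ ℓ ∸ δ A (src r) ℓ) + δ A (src r) ℓ) ≡⟨ shuffle (δ A (tgt r) ℓ) (κ σ ℓ ∸ δ A (src r) ℓ) (δ A (src r) ℓ) ⟩
      δ A (src r) ℓ + ((κ σ ℓ ∸ δ A (src r) ℓ) + δ A (tgt r) ℓ) ∎
      where
      open ≡-Reasoning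
      shuffle : ∀ x y z → x + (y + z) ≡ z + (y + x)
      shuffle = solve-∀

  run-Balanced : ∀ {σ τ σ′} → Run A σ τ σ′ → Balanced (occ A τ) (κ σ) (κ σ′)
  run-Balanced (done (κ≡ , _ , _)) = Balanced-0 (λ _ → refl) κ≡
  run-Balanced {σ} {r ∷ τ} (step (occupied , _) run) =
    Balanced-cong (λ r′ → sym (occ-∷ r τ r′)) (Balanced-⊕ (apply-Balanced r σ occupied) (run-Balanced run))

  updates : RuleVec A → Fin nG → ℕ
  updates X z = Σℕ nR (λ r → X r * inc r z)

  updates-cong : ∀ {X Y} → (∀ r → X r ≡ Y r) → ∀ z → updates X z ≡ updates Y z
  updates-cong X≗Y z = Σℕ-cong nR (λ r → cong (_* inc r z) (X≗Y r))

  updates-⊕ : ∀ X Y z → updates (X ⊕ Y) z ≡ updates X z + updates Y z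
  updates-⊕ X Y z = trans (Σℕ-cong nR (λ r → ℕP.*-distribʳ-+ (inc r z) (X r) (Y r))) (Σℕ-+ nR _ _)

  updates-unit : ∀ x z → updates (unit x) z ≡ inc x z
  updates-unit x z = trans (Σℕ-cong nR (λ r → ind-1-* (does (r ≟ᶠ x)) (inc r z))) (Σℕ-pick nR (λ r → inc r z) x)

  updates-0 : ∀ {X} → (∀ r → X r ≡ 0) → ∀ z → updates X z ≡ 0
  updates-0 X≗0 z = Σℕ-0 nR (λ r → cong (_* inc r z) (X≗0 r))

  Increments : RuleVec A → Config A → Config A → Set
  Increments X σ σ′ = ∀ z → updates X z + gv σ z ≡ gv σ′ z

  CondΓ⇔Increments : ∀ σ σ′ X → CondΓ A σ σ′ X ⇔ Increments X σ σ′
  CondΓ⇔Increments σ σ′ X =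
    mk⇔ (λ condΓ z → Equivalence.to (pos-≡-−⇔+≡ (updates X z) (gv σ z) (gv σ′ z)) (condΓ z))
        (λ increments z → Equivalence.from (pos-≡-−⇔+≡ (updates X z) (gv σ z) (gv σ′ z)) (increments z))

  run-Increments : ∀ {σ τ σ′} → Run A σ τ σ′ → Increments (occ A τ) σ σ′
  run-Increments {σ} (done (_ , g≡ , _)) z = trans (cong (_+ gv σ z) (updates-0 (λ _ → refl) z)) (g≡ z)
  run-Increments {σ} {r ∷ τ} {σ′} (step _ run) z = begin
    updates (occ A (r ∷ τ)) z + gv σ z                  ≡⟨ cong (_+ gv σ z) (updates-cong (occ-∷ r τ) z) ⟩
    updates (unit r ⊕ occ A τ) z + gv σ z               ≡⟨ cong (_+ gv σ z) (updates-⊕ (unit r) (occ A τ) z) ⟩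
    (updates (unit r) z + updates (occ A τ) z) + gv σ z ≡⟨ cong (λ k → (k + updates (occ A τ) z) + gv σ z) (updates-unit r z) ⟩
    (inc r z + updates (occ A τ) z) + gv σ z            ≡⟨ shuffle (inc r z) (updates (occ A τ) z) (gv σ z) ⟩
    updates (occ A τ) z + (gv σ z + inc r z)            ≡⟨ run-Increments run z ⟩
    gv σ′ z                                             ∎
    where
    open ≡-Reasoning
    shuffle : ∀ x y w → (x + y) + w ≡ y + (w + x)
    shuffle = solve-∀

  occupied-apply⁻¹ : ∀ r σ {ℓ} → tgt r ≢ ℓ → 0 < κ (apply A r σ) ℓ → 0 < κ σ ℓ
  occupied-apply⁻¹ r σ {ℓ} tgt≢ℓ occupied = ℕP.<-≤-trans occupied (begin
    (κ σ ℓ ∸ δ A (src r) ℓ) + δ A (tgt r) ℓ ≡⟨ cong (λ b → (κ σ ℓ ∸ δ A (src r) ℓ) + ind b 1) (does-≢ tgt≢ℓ) ⟩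
    (κ σ ℓ ∸ δ A (src r) ℓ) + 0             ≡⟨ ℕP.+-identityʳ _ ⟩
    κ σ ℓ ∸ δ A (src r) ℓ                   ≤⟨ ℕP.m∸n≤m (κ σ ℓ) (δ A (src r) ℓ) ⟩
    κ σ ℓ                                   ∎)
    where open ℕP.≤-Reasoning

  run-SupportReachable : ∀ {σ τ σ′} → Run A σ τ σ′ → SupportReachable σ (occ A τ)
  run-SupportReachable {σ} {r ∷ τ} (step (occupied , _) run) r′ occ>0 with r ≟ᶠ r′
  ... | yes refl = src r , occupied , [ occ>0 ]
  ... | no  r≢r′ with run-SupportReachable run r′ (subst (0 <_) (occ-∷-other r τ r′ (r≢r′ ∘ sym)) occ>0)
  ...   | ℓ , occupied′ , path with ℓ ≟ᶠ tgt r
  ...     | yes refl = src r , occupied , subst (0 <_) (sym (occ-∷-self r τ)) (s≤s z≤n) ◅ Path-mono (occ>0-∷ r τ) path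
  ...     | no ℓ≢tgt = ℓ , occupied-apply⁻¹ r σ (ℓ≢tgt ∘ sym) occupied′ , Path-mono (occ>0-∷ r τ) path

  run-guard-witness : ∀ {σ τ σ′} r → Run A σ τ σ′ → 0 < occ A τ r →
    ∃[ ρ ] (σ ≼ ρ × ρ ≼ σ′ × _⊨_ A ρ (guards r))
  run-guard-witness {σ} {r₀ ∷ τ} r run@(step (_ , σ⊨φ) run′) occ>0 with r₀ ≟ᶠ r
  ... | yes refl = σ , ≼-refl , Run⇒≼ run , σ⊨φ
  ... | no  r₀≢r with run-guard-witness r run′ (subst (0 <_) (occ-∷-other r₀ τ r (r₀≢r ∘ sym)) occ>0)
  ...   | ρ , apply≼ρ , ρ≼σ′ , ρ⊨φ = ρ , ≼-trans (≼-apply r₀ σ) apply≼ρ , ρ≼σ′ , ρ⊨φ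

  N-cong : ∀ {p q : Fin nP → ℕ} → (∀ i → p i ≡ q i) → N A p ≡ N A q
  N-cong p≗q = cong (λ s → N₀ ℤ.+ s) (Σℤ-cong nP (λ i → cong (λ w → Ncoef i ℤ.* ℤ.+ w) (p≗q i)))
    where
    Σℤ-cong : ∀ n {f g : Fin n → ℤ} → (∀ i → f i ≡ g i) → Σℤ n f ≡ Σℤ n g
    Σℤ-cong zero    f≗g = refl
    Σℤ-cong (suc n) f≗g = cong₂ ℤ._+_ (f≗g zero) (Σℤ-cong n (λ i → f≗g (suc i)))

  run-Base₀ : ∀ {σ τ σ′} → Run A σ τ σ′ → IsConfig A σ → Base₀ A σ σ′
  run-Base₀ run (rc , _) = pv-≡ (Run⇒≼ run) , rc , N-cong (pv-≡ (Run⇒≼ run))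

  -- Realising a solution by a schedule

  Realizable : Config A → Config A → RuleVec A → Set
  Realizable σ σ′ X = ∃[ τ ] (Run A σ τ σ′ × (∀ r → occ A τ r ≡ X r))

  GuardsHoldBetween : Config A → Config A → RuleVec A → Set
  GuardsHoldBetween σ σ′ X = ∀ r ρ → 0 < X r → σ ≼ ρ → (∀ z → gv ρ z + inc r z ≤ gv σ′ z) → _⊨_ A ρ (guards r)

  record Solution (σ σ′ : Config A) (X : RuleVec A) : Set where
    field
      params     : ∀ i → pv σ i ≡ pv σ′ i
      balanced   : Balanced X (κ σ) (κ σ′)
      increments : Increments X σ σ′
      reachable  : SupportReachable σ X
      guarded    : GuardsHoldBetween σ σ′ X

  -- A trail lists its rules last-first.
  data Trail (ℓ₀ : Fin nL) : Fin nL → List (Fin nR) → Set where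
    []  : Trail ℓ₀ ℓ₀ []
    _▷_ : ∀ {ℓ t r} → Trail ℓ₀ ℓ t → src r ≡ ℓ → Trail ℓ₀ (tgt r) (r ∷ t)

  Fits : RuleVec A → List (Fin nR) → Set
  Fits X t = ∀ r → occ A t r ≤ X r

  Stuck : RuleVec A → List (Fin nR) → Fin nL → Set
  Stuck X t ℓ = ∀ r → src r ≡ ℓ → X r ≤ occ A t r

  Fits-∷ : ∀ {X r t} → Fits X t → occ A t r < X r → Fits X (r ∷ t)
  Fits-∷ {X} {r} {t} fits occ<X r′ with r ≟ᶠ r′
  ... | yes refl = subst (_≤ X r) (sym (occ-∷-self r t)) occ<X
  ... | no  r≢r′ = subst (_≤ X r′) (sym (occ-∷-other r t r′ (r≢r′ ∘ sym))) (fits r′)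

  Trail-Balanced : ∀ {ℓ₀ ℓ t} → Trail ℓ₀ ℓ t → Balanced (occ A t) (δ A ℓ₀) (δ A ℓ)
  Trail-Balanced [] = Balanced-0 (λ _ → refl) (λ _ → refl)
  Trail-Balanced (_▷_ {t = t} {r} trail refl) =
    Balanced-cong (λ r′ → trans (ℕP.+-comm (occ A t r′) (unit r r′)) (sym (occ-∷ r t r′)))
      (Balanced-⊕ (Trail-Balanced trail) (Balanced-unit r (λ ℓ′ → ℕP.+-comm (δ A (tgt r) ℓ′) (δ A (src r) ℓ′))))

  extendToStuck : ∀ {ℓ₀} X fuel {r t} → Trail ℓ₀ (tgt r) (r ∷ t) → Fits X (r ∷ t) →
    Σℕ nR X ≤ Σℕ nR (occ A (r ∷ t)) + fuel →
    ∃[ r′ ] ∃[ t′ ] (Trail ℓ₀ (src r′) t′ × Fits X (r′ ∷ t′) × Stuck X (r′ ∷ t′) (tgt r′))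
  extendToStuck X fuel {r} {t} trail@(trail′ ▷ src≡) fits ΣX≤
    with any? (λ r′ → (src r′ ≟ᶠ tgt r) ×-dec (occ A (r ∷ t) r′ <? X r′))
  ... | no cannot-extend = r , t , subst (λ ℓ → Trail _ ℓ t) (sym src≡) trail′ , fits ,
                           λ r′ src≡tgt → ℕP.≮⇒≥ (λ occ<X → cannot-extend (r′ , src≡tgt , occ<X))
  extendToStuck X zero {r} {t} trail fits ΣX≤ | yes (r′ , _ , occ<X) =
    ⊥-elim (ℕP.<⇒≱ (Σℕ-mono-< nR fits r′ occ<X) (subst (Σℕ nR X ≤_) (ℕP.+-identityʳ _) ΣX≤))
  extendToStuck X (suc fuel) {r} {t} trail fits ΣX≤ | yes (r′ , src≡tgt , occ<X) =
    extendToStuck X fuel (trail ▷ src≡tgt) (Fits-∷ fits occ<X)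
      (subst (Σℕ nR X ≤_) (trans (ℕP.+-suc _ fuel) (cong (_+ fuel) (sym (Σℕ-occ-∷ r′ (r ∷ t))))) ΣX≤)

  firstRule : ∀ {X ℓ r} → Path X ℓ r → ∃[ r₁ ] (src r₁ ≡ ℓ × 0 < X r₁)
  firstRule {r = r} [ Xr>0 ]         = r , refl , Xr>0
  firstRule (_◅_ {r′ = r′} Xr′>0 _) = r′ , refl , Xr′>0

  record StuckTrail (σ : Config A) (X : RuleVec A) : Set where
    field
      origin   : Fin nL
      occupied : 0 < κ σ origin
      last     : Fin nR
      earlier  : List (Fin nR)
      trail    : Trail origin (src last) earlier
      fits     : Fits X (last ∷ earlier)
      stuck    : Stuck X (last ∷ earlier) (tgt last)

  stuckTrail : ∀ {σ X} → SupportReachable σ X → ∀ r → 0 < X r → StuckTrail σ X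
  stuckTrail {σ} {X} reachable r Xr>0 with reachable r Xr>0
  ... | ℓ₀ , occupied , path with firstRule path
  ... | r₁ , refl , Xr₁>0 with extendToStuck X (Σℕ nR X) ([] ▷ refl) (Fits-∷ (λ _ → z≤n) Xr₁>0) (ℕP.m≤n+m _ _)
  ... | last , earlier , trail , fits , stuck = record
    { origin = src r₁ ; occupied = occupied ; last = last ; earlier = earlier
    ; trail = trail ; fits = fits ; stuck = stuck }

  stuckTrail-target-occupied : ∀ {σ σ′ : Config A} {X} → Balanced X (κ σ) (κ σ′) → (st : StuckTrail σ X) →
    0 < κ σ′ (tgt (StuckTrail.last st))
  stuckTrail-target-occupied {σ} {σ′} {X} balanced st = ℕP.+-cancelˡ-≤ O 1 (κ σ′ v) (begin
    O + 1                        ≡⟨ cong (λ b → O + ind b 1) (does-refl v) ⟨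
    O + δ A v v                  ≡⟨ Trail-Balanced (trail ▷ refl) v ⟨
    I + δ A origin v             ≤⟨ ℕP.+-mono-≤ (flow-mono-≤ tgt v (λ r _ → fits r)) (ind-≟-≤ (κ σ) origin occupied v) ⟩
    flow tgt X v + κ σ v         ≡⟨ balanced v ⟩
    flow src X v + κ σ′ v        ≤⟨ ℕP.+-monoˡ-≤ (κ σ′ v) (flow-mono-≤ src v stuck) ⟩
    O + κ σ′ v                   ∎)
    where
    open StuckTrail st
    open ℕP.≤-Reasoning
    v : Fin nL
    v = tgt last
    I O : ℕ
    I = flow tgt (occ A (last ∷ earlier)) v
    O = flow src (occ A (last ∷ earlier)) v

  unit-≤ : ∀ (X : RuleVec A) {x} → 0 < X x → ∀ r → unit x r ≤ X r
  unit-≤ X {x} Xx>0 r with r ≟ᶠ x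
  ... | yes refl = Xx>0
  ... | no  _    = z≤n

  remove : Fin nR → RuleVec A → RuleVec A
  remove x X r = X r ∸ unit x r

  remove-≤ : ∀ x X r → remove x X r ≤ X r
  remove-≤ x X r = ℕP.m∸n≤m (X r) (unit x r)

  remove-other : ∀ {x} X {r} → r ≢ x → remove x X r ≡ X r
  remove-other X {r} r≢x = cong (λ b → X r ∸ ind b 1) (does-≢ r≢x)

  remove-self : ∀ x X → remove x X x ≡ X x ∸ 1
  remove-self x X = cong (λ b → X x ∸ ind b 1) (does-refl x)

  unit⊕remove : ∀ (X : RuleVec A) {x} → 0 < X x → ∀ r → X r ≡ (unit x ⊕ remove x X) r
  unit⊕remove X {x} Xx>0 r =
    trans (sym (ℕP.m∸n+n≡m (unit-≤ X Xx>0 r))) (ℕP.+-comm (remove x X r) (unit x r))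

  Σℕ-remove : ∀ (X : RuleVec A) {x} → 0 < X x → suc (Σℕ nR (remove x X)) ≡ Σℕ nR X
  Σℕ-remove X {x} Xx>0 = begin
    suc (Σℕ nR (remove x X))                ≡⟨ ℕP.+-comm 1 _ ⟩
    Σℕ nR (remove x X) + 1                  ≡⟨ cong (Σℕ nR (remove x X) +_) (Σℕ-pick nR (λ _ → 1) x) ⟨
    Σℕ nR (remove x X) + Σℕ nR (unit x)     ≡⟨ Σℕ-∸ nR X (unit x) (unit-≤ X Xx>0) ⟩
    Σℕ nR X                                 ∎
    where open ≡-Reasoning

  unapply : Fin nR → Config A → Config A
  unapply r σ = record
    { κ  = λ ℓ → (κ σ ℓ ∸ δ A (tgt r) ℓ) + δ A (src r) ℓ
    ; gv = λ z → gv σ z ∸ inc r z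
    ; pv = pv σ }

  unapply-occupied : ∀ r σ → 0 < κ (unapply r σ) (src r)
  unapply-occupied r σ = subst (λ b → 0 < (κ σ (src r) ∸ δ A (tgt r) (src r)) + ind b 1) (sym (does-refl (src r)))
                               (subst (0 <_) (ℕP.+-comm 1 _) (s≤s z≤n))

  apply-unapply-κ : ∀ r σ → 0 < κ σ (tgt r) → ∀ ℓ → κ (apply A r (unapply r σ)) ℓ ≡ κ σ ℓ
  apply-unapply-κ r σ occupied ℓ =
    trans (cong (_+ δ A (tgt r) ℓ) (ℕP.m+n∸n≡m (κ σ ℓ ∸ δ A (tgt r) ℓ) (δ A (src r) ℓ)))
          (ℕP.m∸n+n≡m (ind-≟-≤ (κ σ) (tgt r) occupied ℓ))

  apply-unapply : ∀ r σ → 0 < κ σ (tgt r) → (∀ z → inc r z ≤ gv σ z) → apply A r (unapply r σ) ≋ σ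
  apply-unapply r σ occupied inc≤gv =
    apply-unapply-κ r σ occupied , (λ z → ℕP.m∸n+n≡m (inc≤gv z)) , (λ _ → refl)

  unapply-Balanced : ∀ r σ → 0 < κ σ (tgt r) → Balanced (unit r) (κ (unapply r σ)) (κ σ)
  unapply-Balanced r σ occupied =
    Balanced-congʳ (apply-unapply-κ r σ occupied)
                   (apply-Balanced r (unapply r σ) (unapply-occupied r σ))

  Path-avoid : ∀ {X Y ℓ r′} x → (∀ r → r ≢ x → 0 < X r → 0 < Y r) → r′ ≢ x →
    Path X ℓ r′ → Path Y ℓ r′ ⊎ Path Y (tgt x) r′
  Path-avoid x X⇒Y r′≢x [ Xr′>0 ] = inj₁ [ X⇒Y _ r′≢x Xr′>0 ]
  Path-avoid x X⇒Y r′≢x (_◅_ {r′ = r} Xr>0 path) with Path-avoid x X⇒Y r′≢x path | r ≟ᶠ x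
  ... | inj₁ path′ | yes refl = inj₂ path′
  ... | inj₁ path′ | no  r≢x  = inj₁ (X⇒Y r r≢x Xr>0 ◅ path′)
  ... | inj₂ path′ | _        = inj₂ path′

  Trail-prefix : ∀ {ℓ₀ ℓ t x} → Trail ℓ₀ ℓ t → x ∈ t →
    ∃[ t′ ] (Trail ℓ₀ (src x) t′ × (∀ {y} → y ∈ t′ → y ∈ t))
  Trail-prefix (_▷_ {t = t} trail refl) (here refl) = t , trail , there
  Trail-prefix (trail ▷ _) (there x∈t) with Trail-prefix trail x∈t
  ... | t′ , trail′ , t′⊆t = t′ , trail′ , there ∘ t′⊆t

  Trail-◅ : ∀ {ℓ₀ ℓ t Y r} → Trail ℓ₀ ℓ t → (∀ {y} → y ∈ t → 0 < Y y) → Path Y ℓ r → Path Y ℓ₀ r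
  Trail-◅ []                   positive path = path
  Trail-◅ (_▷_ {r = x} trail refl) positive path = Trail-◅ trail (positive ∘ there) (positive (here refl) ◅ path)

  remove-SupportReachable : ∀ {σ X} → SupportReachable σ X → (st : StuckTrail σ X) →
    SupportReachable σ (remove (StuckTrail.last st) X)
  remove-SupportReachable {σ} {X} reachable st = reachable⁻
    where
    open StuckTrail st
    X⁻ : RuleVec A
    X⁻ = remove last X

    support-kept : 1 < X last → ∀ r → 0 < X r → 0 < X⁻ r
    support-kept Xlast>1 r Xr>0 with r ≟ᶠ last
    ... | yes refl = ℕP.m<n⇒0<n∸m Xlast>1
    ... | no  _    = Xr>0

    removed-≢ : X last ≤ 1 → ∀ {r} → 0 < X⁻ r → r ≢ last
    removed-≢ Xlast≤1 X⁻r>0 refl = ℕP.<-irrefl (sym (trans (remove-self last X) (ℕP.m≤n⇒m∸n≡0 Xlast≤1))) X⁻r>0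

    exit-in-earlier : X last ≤ 1 → ∀ {r} → src r ≡ tgt last → 0 < X⁻ r → r ∈ earlier
    exit-in-earlier Xlast≤1 {r} src≡ X⁻r>0 = occ>0⇒∈ earlier r
      (subst (0 <_) (occ-∷-other last earlier r (removed-≢ Xlast≤1 X⁻r>0))
        (ℕP.<-≤-trans (ℕP.<-≤-trans X⁻r>0 (remove-≤ last X r)) (stuck r src≡)))

    earlier-positive : X last ≤ 1 → ∀ {y} → y ∈ earlier → 0 < X⁻ y
    earlier-positive Xlast≤1 {y} y∈ = subst (0 <_) (sym (remove-other X y≢last))
                                        (ℕP.<-≤-trans occ>0 (ℕP.≤-trans (occ-≤-∷ last earlier y) (fits y)))
      where
      occ>0 : 0 < occ A earlier y
      occ>0 = ∈⇒occ>0 earlier y y∈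
      last∉earlier : occ A earlier last ≡ 0
      last∉earlier = ℕP.n≤0⇒n≡0 (ℕP.≤-pred (ℕP.≤-trans (ℕP.≤-reflexive (sym (occ-∷-self last earlier)))
                                                       (ℕP.≤-trans (fits last) Xlast≤1)))
      y≢last : y ≢ last
      y≢last refl = ℕP.<-irrefl (sym last∉earlier) occ>0

    -- If the last rule is used only once, a path through it is rerouted along the trail.
    reachable⁻ : SupportReachable σ X⁻
    reachable⁻ r′ X⁻r′>0 with reachable r′ (ℕP.<-≤-trans X⁻r′>0 (remove-≤ last X r′)) | X last ≤? 1
    ... | ℓ , occupied′ , path | no Xlast≰1 = ℓ , occupied′ , Path-mono (support-kept (ℕP.≰⇒> Xlast≰1)) path
    ... | ℓ , occupied′ , path | yes Xlast≤1
      with Path-avoid last (λ r r≢x Xr>0 → subst (0 <_) (sym (remove-other X r≢x)) Xr>0)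
                           (removed-≢ Xlast≤1 X⁻r′>0) path
    ...   | inj₁ path′ = ℓ , occupied′ , path′
    ...   | inj₂ path′ with firstRule path′
    ...     | r₁ , src≡ , X⁻r₁>0 with Trail-prefix trail (exit-in-earlier Xlast≤1 src≡ X⁻r₁>0)
    ...       | _ , prefix , prefix⊆earlier =
      origin , occupied ,
      Trail-◅ prefix (earlier-positive Xlast≤1 ∘ prefix⊆earlier) (subst (λ ℓ → Path X⁻ ℓ r′) (sym src≡) path′)

  peelLast : ∀ {σ σ′ X} → Solution σ σ′ X → 0 < Σℕ nR X →
    ∃[ r ] (0 < X r × Solution σ (unapply r σ′) (remove r X)
            × Enabled A (unapply r σ′) r × apply A r (unapply r σ′) ≋ σ′)
  peelLast {σ} {σ′} {X} sol ΣX>0 =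
    r , Xr>0 , sol⁻ , enabled , apply-unapply r σ′ (stuckTrail-target-occupied {σ′ = σ′} balanced st) inc≤gv
    where
    open Solution sol
    st : StuckTrail σ X
    st = stuckTrail {σ} {X} reachable (proj₁ (Σℕ>0⇒>0 nR X ΣX>0)) (proj₂ (Σℕ>0⇒>0 nR X ΣX>0))
    r : Fin nR
    r = StuckTrail.last st
    σ″ : Config A
    σ″ = unapply r σ′

    Xr>0 : 0 < X r
    Xr>0 = ℕP.<-≤-trans (subst (0 <_) (sym (occ-∷-self r _)) (s≤s z≤n)) (StuckTrail.fits st r)

    increments-split : ∀ z → inc r z + (updates (remove r X) z + gv σ z) ≡ gv σ′ z
    increments-split z = begin
      inc r z + (updates (remove r X) z + gv σ z)               ≡⟨ ℕP.+-assoc (inc r z) _ _ ⟨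
      (inc r z + updates (remove r X) z) + gv σ z               ≡⟨ cong (λ k → (k + updates (remove r X) z) + gv σ z) (updates-unit r z) ⟨
      (updates (unit r) z + updates (remove r X) z) + gv σ z    ≡⟨ cong (_+ gv σ z) (updates-⊕ (unit r) (remove r X) z) ⟨
      updates (unit r ⊕ remove r X) z + gv σ z                  ≡⟨ cong (_+ gv σ z) (updates-cong (unit⊕remove X Xr>0) z) ⟨
      updates X z + gv σ z                                      ≡⟨ increments z ⟩
      gv σ′ z                                                   ∎
      where open ≡-Reasoning

    inc≤gv : ∀ z → inc r z ≤ gv σ′ z
    inc≤gv z = subst (inc r z ≤_) (increments-split z) (ℕP.m≤m+n _ _)

    increments⁻ : Increments (remove r X) σ σ″
    increments⁻ z = trans (sym (ℕP.m+n∸m≡n (inc r z) _)) (cong (_∸ inc r z) (increments-split z))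

    σ≼σ″ : σ ≼ σ″
    σ≼σ″ = (λ z → subst (gv σ z ≤_) (increments⁻ z) (ℕP.m≤n+m _ _)) , params

    balanced⁻ : Balanced (remove r X) (κ σ) (κ σ″)
    balanced⁻ = Balanced-cancelʳ
      (Balanced-cong (λ r′ → trans (unit⊕remove X Xr>0 r′) (ℕP.+-comm (unit r r′) _)) balanced)
      (unapply-Balanced r σ′ (stuckTrail-target-occupied {σ′ = σ′} balanced st))

    guarded⁻ : GuardsHoldBetween σ σ″ (remove r X)
    guarded⁻ r′ ρ X⁻r′>0 σ≼ρ ρ≤σ″ =
      guarded r′ ρ (ℕP.<-≤-trans X⁻r′>0 (remove-≤ r X r′)) σ≼ρ
              (λ z → ℕP.≤-trans (ρ≤σ″ z) (ℕP.m∸n≤m (gv σ′ z) (inc r z)))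

    sol⁻ : Solution σ σ″ (remove r X)
    sol⁻ = record { params = params ; balanced = balanced⁻ ; increments = increments⁻
                  ; reachable = remove-SupportReachable reachable st ; guarded = guarded⁻ }

    enabled : Enabled A σ″ r
    enabled = unapply-occupied r σ′ , guarded r σ″ Xr>0 σ≼σ″ (λ z → ℕP.≤-reflexive (ℕP.m∸n+n≡m (inc≤gv z)))

  realize : ∀ n {σ σ′ X} → Σℕ nR X ≡ n → Solution σ σ′ X → Realizable σ σ′ X
  realize zero {σ} {σ′} {X} ΣX≡0 sol =
    [] , done (Balanced-0⁻¹ X≗0 balanced , (λ z → trans (cong (_+ gv σ z) (sym (updates-0 X≗0 z))) (increments z)) , params) ,
    λ r → sym (X≗0 r)
    where
    open Solution sol
    X≗0 : ∀ r → X r ≡ 0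
    X≗0 = Σℕ≡0⇒≡0 nR X ΣX≡0
  realize (suc n) {X = X} ΣX≡ sol with peelLast sol (subst (0 <_) (sym ΣX≡) (s≤s z≤n))
  ... | r , Xr>0 , sol⁻ , enabled , applied with realize n (ℕP.suc-injective (trans (Σℕ-remove X Xr>0) ΣX≡)) sol⁻
  ... | τ , run , occ≡ = τ ++ r ∷ [] , Run-++ run (step enabled (done applied)) , occ-ok
    where
    occ-ok : ∀ r′ → occ A (τ ++ r ∷ []) r′ ≡ X r′
    occ-ok r′ = begin
      occ A (τ ++ r ∷ []) r′          ≡⟨ occ-++ τ (r ∷ []) r′ ⟩
      occ A τ r′ + occ A (r ∷ []) r′  ≡⟨ cong₂ _+_ (occ≡ r′) (trans (occ-∷ r [] r′) (ℕP.+-identityʳ _)) ⟩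
      remove r X r′ + unit r r′       ≡⟨ ℕP.+-comm (remove r X r′) _ ⟩
      (unit r ⊕ remove r X) r′        ≡⟨ unit⊕remove X Xr>0 r′ ⟨
      X r′                            ∎
      where open ≡-Reasoning

  sameContext-between : ∀ {σ ρ σ′} → SameContext A σ σ′ → σ ≼ ρ → ρ ≼ σ′ →
    ∀ {g} → g ∈ Φ A → σ ⊨ᵍ g ⇔ ρ ⊨ᵍ g
  sameContext-between {σ} {ρ} {σ′} same σ≼ρ ρ≼σ′ {g} g∈Φ with kind-cases g
  ... | inj₁ k = mk⇔ (rise-⊨-mono g k σ≼ρ) back
    where
    back : ρ ⊨ᵍ g → σ ⊨ᵍ g
    back ρ⊨g with Equivalence.from (same g) (g∈Φ , inj₁ (k , rise-⊨-mono g k ρ≼σ′ ρ⊨g))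
    ... | _ , inj₁ (_ , σ⊨g) = σ⊨g
    ... | _ , inj₂ (k′ , _)  = ⊥-elim (rise≢fall {g} k k′)
  ... | inj₂ k = mk⇔ forth (fall-⊨-antimono g k σ≼ρ)
    where
    forth : σ ⊨ᵍ g → ρ ⊨ᵍ g
    forth σ⊨g with σ′ ⊨ᵍ? g
    ... | yes σ′⊨g = fall-⊨-antimono g k ρ≼σ′ σ′⊨g
    ... | no  σ′⊭g with Equivalence.from (same g) (g∈Φ , inj₂ (k , σ′⊭g))
    ...   | _ , inj₁ (k′ , _)  = ⊥-elim (rise≢fall {g} k′ k)
    ...   | _ , inj₂ (_ , σ⊭g) = ⊥-elim (σ⊭g σ⊨g)

  steady⇒GuardsHoldBetween : ∀ {σ σ′ X} → (∀ i → pv σ i ≡ pv σ′ i) → SameContext A σ σ′ → CondR A σ X →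
    GuardsHoldBetween σ σ′ X
  steady⇒GuardsHoldBetween {σ} {σ′} params same condR r ρ Xr>0 σ≼ρ ρ+inc≤σ′ =
    ⊨-map (guards r) (λ g∈ → Equivalence.to (sameContext-between same σ≼ρ ρ≼σ′ (guard∈Φ r g∈))) (condR r Xr>0)
    where
    ρ≼σ′ : ρ ≼ σ′
    ρ≼σ′ = (λ z → ℕP.≤-trans (ℕP.m≤m+n _ _) (ρ+inc≤σ′ z)) , (λ i → trans (sym (pv-≡ σ≼ρ i)) (params i))

  step⇒GuardsHoldBetween : ∀ {σ σ′ Y} → Increments Y σ σ′ → CondR A σ Y → Σℕ nR Y ≤ 1 →
    GuardsHoldBetween σ σ′ Y
  step⇒GuardsHoldBetween {σ} {σ′} {Y} increments condR ΣY≤1 r ρ Yr>0 σ≼ρ ρ+inc≤σ′ with Σℕ≤1⇒ nR Y ΣY≤1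
  ... | inj₁ Y≗0         = ⊥-elim (ℕP.<-irrefl (sym (Y≗0 r)) Yr>0)
  ... | inj₂ (j , Y≗unit) = ⊨-cong (guards r) σ≼ρ ρ≼σ (condR r Yr>0)
    where
    Y≗unit-r : ∀ r′ → Y r′ ≡ unit r r′
    Y≗unit-r r′ with r ≟ᶠ j
    ... | yes refl = Y≗unit r′
    ... | no  r≢j  = ⊥-elim (ℕP.<-irrefl (sym (trans (Y≗unit r) (cong (λ b → ind b 1) (does-≢ r≢j)))) Yr>0)
    ρ≼σ : ρ ≼ σ
    ρ≼σ = (λ z → ℕP.+-cancelʳ-≤ (inc r z) _ _ (ℕP.≤-trans (ρ+inc≤σ′ z) (ℕP.≤-reflexive (begin
            gv σ′ z                         ≡⟨ increments z ⟨
            updates Y z + gv σ z            ≡⟨ cong (_+ gv σ z) (trans (updates-cong Y≗unit-r z) (updates-unit r z)) ⟩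
            inc r z + gv σ z                ≡⟨ ℕP.+-comm (inc r z) (gv σ z) ⟩
            gv σ z + inc r z                ∎))))
        , (λ i → sym (pv-≡ σ≼ρ i))
      where open ≡-Reasoning

  steady⇒Solution : ∀ {σ σ′ X} → Steady A σ σ′ X → Solution σ σ′ X
  steady⇒Solution {σ} {σ′} {X} ((params , _ , _) , same , condL , condΓ , condR , condAppl) = record
    { params     = params
    ; balanced   = Equivalence.to (CondL⇔Balanced σ σ′ X) condL
    ; increments = Equivalence.to (CondΓ⇔Increments σ σ′ X) condΓ
    ; reachable  = Equivalence.to (CondAppl⇔SupportReachable σ X) condAppl
    ; guarded    = steady⇒GuardsHoldBetween {σ} {σ′} {X} params same condR }

  step⇒Solution : ∀ {η η′ Y} → Step A η η′ Y → Solution η η′ Y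
  step⇒Solution {η} {η′} {Y} ((params , _ , _) , condL , condΓ , condR , condAppl , ΣY≤1) = record
    { params     = params
    ; balanced   = Equivalence.to (CondL⇔Balanced η η′ Y) condL
    ; increments = increments
    ; reachable  = Equivalence.to (CondAppl⇔SupportReachable η Y) condAppl
    ; guarded    = step⇒GuardsHoldBetween {η} {η′} {Y} increments condR ΣY≤1 }
    where
    increments : Increments Y η η′
    increments = Equivalence.to (CondΓ⇔Increments η η′ Y) condΓ

  solution⇒Realizable : ∀ {σ σ′ X} → Solution σ σ′ X → Realizable σ σ′ X
  solution⇒Realizable sol = realize _ refl sol

  Realizable-++ : ∀ {σ ρ θ X Y} → Realizable σ ρ X → Realizable ρ θ Y → Realizable σ θ (X ⊕ Y)
  Realizable-++ (τ , run , occ≡) (τ′ , run′ , occ≡′) =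
    τ ++ τ′ , Run-++ run run′ , λ r → trans (occ-++ τ τ′ r) (cong₂ _+_ (occ≡ r) (occ≡′ r))

  -- ReachWith A is ReachIn (K A).
  ReachIn : ℕ → Config A → Config A → RuleVec A → Set
  ReachIn m σ σ′ z =
    Σ (Fin (suc m) → Config A) λ σs →
    Σ (Fin (suc m) → Config A) λ σs′ →
    Σ (Fin (suc m) → RuleVec A) λ x →
    Σ (Fin m → RuleVec A) λ y →
        (∀ i → IsConfig A (σs i)) × (∀ i → IsConfig A (σs′ i))
      × σs zero ≋ σ × σs′ (fromℕ m) ≋ σ′
      × (∀ i → Steady A (σs i) (σs′ i) (x i))
      × (∀ (i : Fin m) → Step A (σs′ (inject₁ i)) (σs (suc i)) (y i))
      × (∀ r → z r ≡ Σℕ (suc m) (λ i → x i r) + Σℕ m (λ i → y i r))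

  ReachIn⇒Realizable : ∀ m {σ σ′ z} → ReachIn m σ σ′ z → Realizable σ σ′ z
  ReachIn⇒Realizable zero (σs , σs′ , x , y , _ , _ , σs₀≋ , σs′₀≋ , steadies , _ , z≡) =
    let (τ , run , occ≡) = solution⇒Realizable (steady⇒Solution (steadies zero)) in
    τ , Run-≋ˡ σs₀≋ (Run-≋ʳ run σs′₀≋) ,
    λ r → trans (occ≡ r) (sym (trans (z≡ r) (trans (ℕP.+-identityʳ _) (ℕP.+-identityʳ _))))
  ReachIn⇒Realizable (suc m) {σ′ = σ′} (σs , σs′ , x , y , isConfig , isConfig′ , σs₀≋ , σs′ₘ≋ , steadies , steps , z≡) =
    let (τ , run , occ≡) = Realizable-++ (solution⇒Realizable (steady⇒Solution (steadies zero)))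
                             (Realizable-++ (solution⇒Realizable (step⇒Solution (steps zero)))
                                            (ReachIn⇒Realizable m tail)) in
    τ , Run-≋ˡ σs₀≋ run , λ r → trans (occ≡ r) (sym (trans (z≡ r) (regroup (x zero r) _ (y zero r) _)))
    where
    tail : ReachIn m (σs (suc zero)) σ′ (λ r → Σℕ (suc m) (λ i → x (suc i) r) + Σℕ m (λ i → y (suc i) r))
    tail = (σs ∘ suc) , (σs′ ∘ suc) , (x ∘ suc) , (y ∘ suc) , (isConfig ∘ suc) , (isConfig′ ∘ suc) ,
           ≋-refl , σs′ₘ≋ , (steadies ∘ suc) , (steps ∘ suc) , (λ r → refl)
    regroup : ∀ a b c d → (a + b) + (c + d) ≡ a + (c + (b + d))
    regroup = solve-∀

  -- Cutting a run at its context changes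

  run⇒Steady : ∀ {σ τ σ′} → Run A σ τ σ′ → IsConfig A σ → SameContext A σ σ′ → Steady A σ σ′ (occ A τ)
  run⇒Steady {σ} {τ} {σ′} run isConfig same =
    run-Base₀ run isConfig , same ,
    Equivalence.from (CondL⇔Balanced σ σ′ (occ A τ)) (run-Balanced run) ,
    Equivalence.from (CondΓ⇔Increments σ σ′ (occ A τ)) (run-Increments run) ,
    condR ,
    Equivalence.from (CondAppl⇔SupportReachable σ (occ A τ)) (run-SupportReachable run)
    where
    condR : CondR A σ (occ A τ)
    condR r occ>0 with run-guard-witness r run occ>0
    ... | ρ , σ≼ρ , ρ≼σ′ , ρ⊨φ =
      ⊨-map (guards r) (λ g∈ → Equivalence.from (sameContext-between same σ≼ρ ρ≼σ′ (guard∈Φ r g∈))) ρ⊨φ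

  run⇒Step : ∀ {η τ η′} → Run A η τ η′ → IsConfig A η → CondR A η (occ A τ) → Σℕ nR (occ A τ) ≤ 1 →
    Step A η η′ (occ A τ)
  run⇒Step {η} {τ} {η′} run isConfig condR Σ≤1 =
    run-Base₀ run isConfig ,
    Equivalence.from (CondL⇔Balanced η η′ (occ A τ)) (run-Balanced run) ,
    Equivalence.from (CondΓ⇔Increments η η′ (occ A τ)) (run-Increments run) ,
    condR ,
    Equivalence.from (CondAppl⇔SupportReachable η (occ A τ)) (run-SupportReachable run) ,
    Σ≤1

  emptyStep : ∀ {η η′} → η ≋ η′ → IsConfig A η → Step A η η′ (occ A [])
  emptyStep η≋η′ isConfig = run⇒Step (done η≋η′) isConfig (λ _ ())
    (subst (_≤ 1) (sym (Σℕ-0 nR (λ _ → refl))) z≤n)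

  singleStep : ∀ {η r η′} → Run A η (r ∷ []) η′ → IsConfig A η → Step A η η′ (occ A (r ∷ []))
  singleStep {η} {r} run@(step (_ , η⊨φ) _) isConfig =
    run⇒Step run isConfig condR (ℕP.≤-reflexive (trans (Σℕ-occ-∷ r []) (cong suc (Σℕ-0 nR (λ _ → refl)))))
    where
    condR : CondR A η (occ A (r ∷ []))
    condR r′ occ>0 with r ≟ᶠ r′
    ... | yes refl = η⊨φ
    ... | no  r≢r′ = ⊥-elim (ℕP.<-irrefl (sym (occ-∷-other r [] r′ (r≢r′ ∘ sym))) occ>0)

  Step-≋ʳ : ∀ {η η′ η″ Y} → η′ ≋ η″ → Step A η η′ Y → Step A η η″ Y
  Step-≋ʳ {η} {η′} {η″} {Y} (κ≡ , g≡ , p≡) ((params , rc , N≡) , condL , condΓ , condR , condAppl , Σ≤1) =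
    ((λ i → trans (params i) (p≡ i)) , rc , trans N≡ (N-cong p≡)) ,
    Equivalence.from (CondL⇔Balanced η η″ Y) (Balanced-congʳ κ≡ (Equivalence.to (CondL⇔Balanced η η′ Y) condL)) ,
    Equivalence.from (CondΓ⇔Increments η η″ Y)
      (λ z → trans (Equivalence.to (CondΓ⇔Increments η η′ Y) condΓ z) (g≡ z)) ,
    condR , condAppl , Σ≤1

  ReachIn-∷ : ∀ {m ρ ρ₁ η σ′ X Y z w} → IsConfig A ρ → IsConfig A ρ₁ → Steady A ρ ρ₁ X → Step A ρ₁ η Y →
    ReachIn m η σ′ z → (∀ r → w r ≡ X r + (Y r + z r)) → ReachIn (suc m) ρ σ′ w
  ReachIn-∷ {ρ = ρ} {ρ₁} {X = X} {Y} isConfig isConfig₁ first-steady first-step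
            (σs , σs′ , x , y , isConfigs , isConfigs′ , σs₀≋ , σs′ₘ≋ , steadies , steps , z≡) w≡ =
    (λ { zero → ρ ; (suc i) → σs i }) , (λ { zero → ρ₁ ; (suc i) → σs′ i }) ,
    (λ { zero → X ; (suc i) → x i }) , (λ { zero → Y ; (suc i) → y i }) ,
    (λ { zero → isConfig ; (suc i) → isConfigs i }) , (λ { zero → isConfig₁ ; (suc i) → isConfigs′ i }) ,
    ≋-refl , σs′ₘ≋ ,
    (λ { zero → first-steady ; (suc i) → steadies i }) ,
    (λ { zero → Step-≋ʳ (≋-sym σs₀≋) first-step ; (suc i) → steps i }) ,
    λ r → trans (w≡ r) (trans (cong (λ k → X r + (Y r + k)) (z≡ r)) (regroup (X r) (Y r) _ _))
    where
    regroup : ∀ a b c d → a + (b + (c + d)) ≡ (a + c) + (b + d)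
    regroup = solve-∀

  ReachIn-pad : ∀ m {ρ τ σ′} → Run A ρ τ σ′ → IsConfig A ρ → IsConfig A σ′ → SameContext A ρ σ′ →
    ReachIn m ρ σ′ (occ A τ)
  ReachIn-pad zero {ρ} {τ} {σ′} run isConfig isConfig′ same =
    (λ _ → ρ) , (λ _ → σ′) , (λ _ → occ A τ) , (λ ()) , (λ _ → isConfig) , (λ _ → isConfig′) ,
    ≋-refl , ≋-refl , (λ _ → run⇒Steady run isConfig same) , (λ ()) ,
    λ r → sym (trans (ℕP.+-identityʳ _) (ℕP.+-identityʳ _))
  ReachIn-pad (suc m) run isConfig isConfig′ same =
    ReachIn-∷ isConfig isConfig′ (run⇒Steady run isConfig same) (emptyStep ≋-refl isConfig′)
      (ReachIn-pad m (done ≋-refl) isConfig′ isConfig′ sameContext-refl) (λ r → sym (ℕP.+-identityʳ _))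

  ContextChanges : Config A → Config A → Set
  ContextChanges ρ ρ′ = ∃[ g ] (g ∈ Φ A × ¬ InContext ρ g × InContext ρ′ g)

  ContextChanges? : ∀ ρ ρ′ → Dec (ContextChanges ρ ρ′)
  ContextChanges? ρ ρ′ = map′ find (λ (_ , g∈ , change) → lose g∈ change)
    (Any.any? (λ g → ¬? (InContext? ρ g) ×-dec InContext? ρ′ g) (Φ A))

  sameContext-apply : ∀ ρ r → ¬ ContextChanges ρ (apply A r ρ) → SameContext A ρ (apply A r ρ)
  sameContext-apply ρ r unchanged = sameContext (λ g → InContext-mono g (≼-apply r ρ)) back
    where
    back : ∀ g → g ∈ Φ A → InContext (apply A r ρ) g → InContext ρ g
    back g g∈ c with InContext? ρ g
    ... | yes c′ = c′
    ... | no  ¬c = ⊥-elim (unchanged (g , g∈ , ¬c , c))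

  record FirstContextChange (ρ : Config A) (τ : Schedule A) (σ′ : Config A) : Set where
    field
      before     : Schedule A
      pivot      : Config A
      rule       : Fin nR
      after      : Schedule A
      τ≡         : τ ≡ before ++ rule ∷ after
      run-before : Run A ρ before pivot
      pivot-isConfig : IsConfig A pivot
      same       : SameContext A ρ pivot
      rule-enabled : Enabled A pivot rule
      run-after  : Run A (apply A rule pivot) after σ′
      changes    : ContextChanges pivot (apply A rule pivot)

  splitAtContextChange : ∀ {ρ τ σ′} → Run A ρ τ σ′ → IsConfig A ρ → SameContext A ρ σ′ ⊎ FirstContextChange ρ τ σ′
  splitAtContextChange (done ρ≋σ′) _ = inj₁ (≋⇒sameContext ρ≋σ′)
  splitAtContextChange {ρ} {r ∷ τ} (step enabled run) isConfig with ContextChanges? ρ (apply A r ρ)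
  ... | yes changes = inj₂ record
    { before = [] ; pivot = ρ ; rule = r ; after = τ ; τ≡ = refl ; run-before = done ≋-refl ; pivot-isConfig = isConfig
    ; same = sameContext-refl ; rule-enabled = enabled ; run-after = run ; changes = changes }
  ... | no unchanged with splitAtContextChange run (IsConfig-apply ρ r isConfig enabled)
  ...   | inj₁ same   = inj₁ (sameContext-trans (sameContext-apply ρ r unchanged) same)
  ...   | inj₂ change = inj₂ record
    { before = r ∷ before ; pivot = pivot ; rule = rule ; after = after ; τ≡ = cong (r ∷_) τ≡
    ; run-before = step enabled run-before ; pivot-isConfig = pivot-isConfig
    ; same = sameContext-trans (sameContext-apply ρ r unchanged) same
    ; rule-enabled = rule-enabled ; run-after = run-after ; changes = changes }
    where open FirstContextChange change

  distinctGuards : List (Guard nG nP)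
  distinctGuards = List.deduplicate guard-dec (Φ A)

  outside : Config A → ℕ
  outside ρ = count (λ g → ¬? (InContext? ρ g)) distinctGuards

  outside-≤ : ∀ ρ → outside ρ ≤ ∣Φ∣ A
  outside-≤ ρ = length-filter (λ g → ¬? (InContext? ρ g)) distinctGuards

  outside-< : ∀ {ρ ρ′} → ρ ≼ ρ′ → ContextChanges ρ ρ′ → outside ρ′ < outside ρ
  outside-< {ρ} {ρ′} ρ≼ρ′ (g , g∈ , ¬c , c) =
    count-mono-< (λ g → ¬? (InContext? ρ g)) (λ g → ¬? (InContext? ρ′ g)) (λ ¬c′ c → ¬c′ (InContext-mono _ ρ≼ρ′ c))
      (∈-deduplicate⁺ guard-dec g∈) ¬c (λ ¬c′ → ¬c′ c)

  outside-antimono : ∀ {ρ ρ′} → ρ ≼ ρ′ → outside ρ′ ≤ outside ρ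
  outside-antimono {ρ} {ρ′} ρ≼ρ′ =
    count-mono-≤ (λ g → ¬? (InContext? ρ g)) (λ g → ¬? (InContext? ρ′ g)) (λ ¬c′ c → ¬c′ (InContext-mono _ ρ≼ρ′ c))
      distinctGuards

  FirstContextChange-outside : ∀ {ρ τ σ′} (change : FirstContextChange ρ τ σ′) →
    outside (apply A (FirstContextChange.rule change) (FirstContextChange.pivot change)) < outside ρ
  FirstContextChange-outside change =
    ℕP.<-≤-trans (outside-< (≼-apply rule pivot) changes) (outside-antimono (Run⇒≼ run-before))
    where open FirstContextChange change

  run⇒ReachIn : ∀ m {ρ τ σ′} → Run A ρ τ σ′ → IsConfig A ρ → IsConfig A σ′ → outside ρ ≤ m →
    ReachIn m ρ σ′ (occ A τ)
  run⇒ReachIn m run isConfig isConfig′ bound with splitAtContextChange run isConfig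
  ... | inj₁ same = ReachIn-pad m run isConfig isConfig′ same
  run⇒ReachIn zero run isConfig isConfig′ bound | inj₂ change =
    ⊥-elim (ℕP.n≮0 (ℕP.<-≤-trans (FirstContextChange-outside change) bound))
  run⇒ReachIn (suc m) {ρ} {τ} {σ′} run isConfig isConfig′ bound | inj₂ change =
    subst (ReachIn (suc m) ρ σ′ ∘ occ A) (sym τ≡)
      (ReachIn-∷ isConfig pivot-isConfig (run⇒Steady run-before isConfig same)
        (singleStep (step rule-enabled (done ≋-refl)) pivot-isConfig)
        (run⇒ReachIn m run-after (IsConfig-apply pivot rule pivot-isConfig rule-enabled) isConfig′
          (ℕP.≤-pred (ℕP.<-≤-trans (FirstContextChange-outside change) bound)))
        (λ r → trans (occ-++ before (rule ∷ after) r) (cong (occ A before r +_) (occ-++ (rule ∷ []) after r))))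
    where open FirstContextChange change

lemma5 : (A : TA) → (σ σ' : Config A) → IsConfig A σ → IsConfig A σ'
    → ((z : RuleVec A) → ReachWith A σ σ' z
         → Σ (Schedule A) λ τ → Run A σ τ σ' × (∀ r → occ A τ r ≡ z r))
    × ((τ : Schedule A) → Run A σ τ σ' → ReachWith A σ σ' (occ A τ))
lemma5 A σ σ' isConfig isConfig' =
  (λ z → ReachIn⇒Realizable A (K A)) ,
  (λ τ run → run⇒ReachIn A (K A) run isConfig isConfig' (ℕP.≤-trans (outside-≤ A σ) (ℕP.n≤1+n _)))
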